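{- Let $Q$ be a delta operator with umbral operator $\phi$, let $R$ be another delta operator, let $s\defeq\frac{Q}{R}\phi$ and $s_n(x)\defeq s\,x^n$. Then for every $a\in\mathbb K$, \[ R^{ -1}_{(a)}=\sum_{n=1}^\infty\frac{s_n(0)-s_n(a-\hat x)}{n!}\,Q^{n-1}, \] where $s_n(a-\hat x)$ denotes the operator of multiplication by the polynomial $x\mapsto s_n(a-x)$.
   Context: $\mathbb K$ is a field of characteristic zero; operators are linear maps on $\mathbb K[x]$; $\hat x$ is multiplication by $x$, $D=d/dx$, $E^af(x)=f(x+a)$. A delta operator is an operator commuting with all shifts with $Qx$ a nonzero constant; it has the form $DP$ with $P$ an invertible power series in $D$, and for delta operators $Q=DP$, $R=DS$ one sets $Q/R\defeq PS^{ -1}$. The umbral operator $\phi$ of $Q$ is given by $\phi x^n=\phi_n(x)$ where $(\phi_n)$ is the unique polynomial sequence with $\deg\phi_n=n$, $\phi_0=1$, $\phi_n(0)=0$ ($n\ge1$), $Q\phi_n=n\phi_{n-1}$. The sigma operator $R^{ -1}$ is the unique linear operator with $RR^{ -1}=1$ and $R^{ -1}R=1-\mathcal E_0$ ($\mathcal E_af\defeq f(a)$ as a constant polynomial), and $R^{ -1}_{(a)}\defeq E^{ -a}R^{ -1}E^a$. -}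

module Defs where

open import Level using (Level; _⊔_) renaming (suc to lsuc)
open import Algebra.Bundles using (CommutativeRing)
open import Data.Nat as ℕ using (ℕ; zero; suc; _∸_; _!; z≤n; s≤s)
open import Data.Nat.Properties as ℕP using ()
open import Data.Product using (Σ; _×_; _,_)
open import Relation.Nullary using (¬_; yes; no; contradiction)
open import Relation.Binary.PropositionalEquality as ≡ using (_≡_)

-- Fields of characteristic zero (no Field bundle in the stdlib).
-- The inverse is a total function, only constrained on nonzero elements.

record Field (c ℓ : Level) : Set (lsuc (c ⊔ ℓ)) where
  field
    commutativeRing : CommutativeRing c ℓ
  open CommutativeRing commutativeRing public
  field
    _⁻¹        : Carrier → Carrier
    ⁻¹-inverse : ∀ x → ¬ (x ≈ 0#) → (x * (x ⁻¹)) ≈ 1#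
    0≉1        : ¬ (0# ≈ 1#)

  fromℕ : ℕ → Carrier
  fromℕ zero    = 0#
  fromℕ (suc n) = 1# + fromℕ n

record CharZeroField (c ℓ : Level) : Set (lsuc (c ⊔ ℓ)) where
  field
    field′   : Field c ℓ
  open Field field′ public
  field
    charZero : ∀ n → ¬ (fromℕ (suc n) ≈ 0#)

module Theory {c ℓ : Level} (K : CharZeroField c ℓ) where
  open CharZeroField K

  Σ< : ℕ → (ℕ → Carrier) → Carrier
  Σ< zero    f = 0#
  Σ< (suc n) f = Σ< n f + f n

  Σ<-zero : ∀ n (f : ℕ → Carrier) → (∀ i → i ℕ.< n → f i ≈ 0#) → Σ< n f ≈ 0#
  Σ<-zero zero    f h = refl
  Σ<-zero (suc n) f h =
    trans (+-cong (Σ<-zero n f (λ i i<n → h i (ℕP.m≤n⇒m≤1+n i<n))) (h n ℕP.≤-refl))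
          (+-identityˡ 0#)

  _^_ : Carrier → ℕ → Carrier
  a ^ zero  = 1#
  a ^ suc n = a * (a ^ n)

  record Poly : Set (c ⊔ ℓ) where
    field
      coeff  : ℕ → Carrier
      bound  : ℕ
      vanish : ∀ n → bound ℕ.≤ n → coeff n ≈ 0#
  open Poly public

  infix 4 _≈P_
  _≈P_ : Poly → Poly → Set ℓ
  p ≈P q = ∀ n → coeff p n ≈ coeff q n

  zeroP : Poly
  zeroP = record { coeff = λ _ → 0# ; bound = 0 ; vanish = λ _ _ → refl }

  constP : Carrier → Poly
  constP a = record { coeff = cf ; bound = 1 ; vanish = v }
    where
    cf : ℕ → Carrier
    cf zero    = a
    cf (suc _) = 0#
    v : ∀ n → 1 ℕ.≤ n → cf n ≈ 0#
    v (suc n) _ = refl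

  X^ : ℕ → Poly
  X^ n = record { coeff = cf ; bound = suc n ; vanish = v }
    where
    cf : ℕ → Carrier
    cf m with m ℕ.≟ n
    ... | yes _ = 1#
    ... | no  _ = 0#
    v : ∀ m → suc n ℕ.≤ m → cf m ≈ 0#
    v m le with m ℕ.≟ n
    ... | yes ≡.refl = contradiction le (ℕP.n≮n m)
    ... | no  _    = refl

  xP : Poly
  xP = X^ 1

  infixl 6 _+P_ _-P_
  infixl 7 _*P_

  _+P_ : Poly → Poly → Poly
  p +P q = record
    { coeff  = λ n → coeff p n + coeff q n
    ; bound  = bound p ℕ.⊔ bound q
    ; vanish = λ n le →
        trans (+-cong (vanish p n (ℕP.≤-trans (ℕP.m≤m⊔n (bound p) (bound q)) le))
                      (vanish q n (ℕP.≤-trans (ℕP.m≤n⊔m (bound p) (bound q)) le)))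
              (+-identityˡ 0#)
    }

  scale : Carrier → Poly → Poly
  scale a p = record
    { coeff  = λ n → a * coeff p n
    ; bound  = bound p
    ; vanish = λ n le → trans (*-congˡ (vanish p n le)) (zeroʳ a)
    }

  negP : Poly → Poly
  negP = scale (- 1#)

  _-P_ : Poly → Poly → Poly
  p -P q = p +P negP q

  _*P_ : Poly → Poly → Poly
  p *P q = record
    { coeff  = λ k → Σ< (suc k) (λ i → coeff p i * coeff q (k ∸ i))
    ; bound  = bound p ℕ.+ bound q
    ; vanish = λ k le → Σ<-zero (suc k) _ (λ i i≤k → term k i le i≤k)
    }
    where
    term : ∀ k i → bound p ℕ.+ bound q ℕ.≤ k → i ℕ.< suc k →
           coeff p i * coeff q (k ∸ i) ≈ 0#
    term k i le (s≤s i≤k) with bound p ℕ.≤? i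
    ... | yes bp≤i = trans (*-congʳ (vanish p i bp≤i)) (zeroˡ _)
    ... | no  bp≰i with bound q ℕ.≤? (k ∸ i)
    ...   | yes bq≤ = trans (*-congˡ (vanish q (k ∸ i) bq≤)) (zeroʳ _)
    ...   | no  bq≰ = contradiction
              (ℕP.≤-trans le (ℕP.≤-reflexive (≡.sym (ℕP.m+[n∸m]≡n i≤k))))
              (ℕP.<⇒≱ (ℕP.+-mono-< (ℕP.≰⇒> bp≰i) (ℕP.≰⇒> bq≰)))

  powP : Poly → ℕ → Poly
  powP q zero    = constP 1#
  powP q (suc k) = q *P powP q k

  ΣP< : ℕ → (ℕ → Poly) → Poly
  ΣP< zero    f = zeroP
  ΣP< (suc n) f = ΣP< n f +P f n

  eval : Carrier → Poly → Carrier
  eval a p = Σ< (bound p) (λ k → coeff p k * (a ^ k))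

  comp : Poly → Poly → Poly
  comp p q = ΣP< (bound p) (λ k → scale (coeff p k) (powP q k))

  DP : Poly → Poly
  DP p = record
    { coeff  = λ k → fromℕ (suc k) * coeff p (suc k)
    ; bound  = bound p
    ; vanish = λ k le → trans (*-congˡ (vanish p (suc k) (ℕP.m≤n⇒m≤1+n le))) (zeroʳ _)
    }

  HasDegree : Poly → ℕ → Set ℓ
  HasDegree p n = (¬ (coeff p n ≈ 0#)) × (∀ m → n ℕ.< m → coeff p m ≈ 0#)

  Op : Set (c ⊔ ℓ)
  Op = Poly → Poly

  infixr 9 _∘O_
  _∘O_ : Op → Op → Op
  (T ∘O U) f = T (U f)

  idO : Op
  idO f = f

  _^O_ : Op → ℕ → Op
  T ^O zero  = idO
  T ^O suc n = T ∘O (T ^O n)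

  infix 4 _≈O_
  _≈O_ : Op → Op → Set (c ⊔ ℓ)
  T ≈O U = ∀ f → T f ≈P U f

  record IsLinear (T : Op) : Set (c ⊔ ℓ) where
    field
      cong  : ∀ f g → f ≈P g → T f ≈P T g
      additive    : ∀ f g → T (f +P g) ≈P T f +P T g
      homogeneous : ∀ a f → T (scale a f) ≈P scale a (T f)

  E : Carrier → Op
  E a f = comp f (xP +P constP a)

  𝓔 : Carrier → Op
  𝓔 a f = constP (eval a f)

  mulO : Poly → Op
  mulO p f = p *P f

  ShiftInvariant : Op → Set (c ⊔ ℓ)
  ShiftInvariant T = ∀ a f → T (E a f) ≈P E a (T f)

  IsDelta : Op → Set (c ⊔ ℓ)
  IsDelta Q = IsLinear Q × ShiftInvariant Q
            × Σ Carrier (λ k → (¬ (k ≈ 0#)) × (Q xP ≈P constP k))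

  Series : Set c
  Series = ℕ → Carrier

  -- (Σ_k s_k D^k) f ; the terms with k ≥ bound f vanish
  applySeries : Series → Op
  applySeries s f = ΣP< (bound f) (λ k → scale (s k) ((DP ^O k) f))

  _⋆_ : Series → Series → Series
  (s ⋆ t) k = Σ< (suc k) (λ i → s i * t (k ∸ i))

  oneS : Series
  oneS zero    = 1#
  oneS (suc _) = 0#

  IsSeriesInverse : Series → Series → Set ℓ
  IsSeriesInverse s t = ∀ k → (s ⋆ t) k ≈ oneS k

  -- Q = D P with P an invertible power series in D
  IsDeltaForm : Op → Series → Set (c ⊔ ℓ)
  IsDeltaForm Q P = (¬ (P 0 ≈ 0#)) × (Q ≈O (DP ∘O applySeries P))

  record IsUmbral (Q : Op) (φseq : ℕ → Poly) (φ : Op) : Set (c ⊔ ℓ) where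
    field
      degree : ∀ n → HasDegree (φseq n) n
      zeroth : φseq 0 ≈P constP 1#
      atZero : ∀ n → eval 0# (φseq (suc n)) ≈ 0#
      lower  : ∀ n → Q (φseq (suc n)) ≈P scale (fromℕ (suc n)) (φseq n)
      linear : IsLinear φ
      onMonomials : ∀ n → φ (X^ n) ≈P φseq n

  record IsSigma (R Rinv : Op) : Set (c ⊔ ℓ) where
    field
      linear : IsLinear Rinv
      right  : ∀ f → R (Rinv f) ≈P f
      left   : ∀ f → Rinv (R f) ≈P (f -P 𝓔 0# f)

  shiftedSigma : Op → Carrier → Op
  shiftedSigma Rinv a = E (- a) ∘O Rinv ∘O E a

  invFact : ℕ → Carrier
  invFact n = (fromℕ (n !)) ⁻¹

-- Put ŝₙ = (Q/R) φₙ / n!. Since Q/R is a power series in D it commutes with Q, and R (Q/R) = Q, so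
-- Q ŝₙ₊₁ = ŝₙ and R ŝₙ₊₁ = φₙ / n!. Two polynomials with the same image under Q and the same value
-- at 0 are equal; this yields the binomial identity ŝₙ(x + u) = Σⱼ ŝⱼ(u) φₙ₋ⱼ(x) / (n - j)!.
-- From R⁻¹ R = 1 - 𝓔₀ one gets R⁻¹_(a) (φₖ / k!) = ŝₖ₊₁(x) - ŝₖ₊₁(a), and the binomial identity at
-- u = 0 and at u = a - x turns this into the claimed sum applied to φₖ / k!, because
-- Qᵐ (φₖ / k!) = φₖ₋ₘ / (k - m)!. Both sides are linear and the φₖ / k! form a triangular basis, so
-- they agree on every polynomial; it suffices to compare values, since in characteristic zero a
-- polynomial vanishing at all natural numbers is zero.

module Submission where

open import Defs
open import Algebra.Bundles using (CommutativeRing)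
open import Algebra.Solver.Ring.AlmostCommutativeRing using (AlmostCommutativeRing; fromCommutativeRing; _-Raw-AlmostCommutative⟶_)
open import Data.Integer as ℤ using (ℤ)
import Data.Integer.Properties as ℤ
open import Data.Maybe using (Maybe; just; nothing)
open import Data.Nat as ℕ using (ℕ; zero; suc; _≤_; _∸_; _<_; z≤n; s≤s; _!)
import Data.Nat.Properties as ℕ
open import Data.Sign as Sign using (Sign)
open import Data.Sum using (inj₁; inj₂)
open import Relation.Nullary using (yes; no; ¬_; contradiction)
open import Relation.Binary.PropositionalEquality as ≡ using (_≡_)
import Algebra.Properties.Ring as RingProperties
import Algebra.Properties.CommutativeSemigroup as CommutativeSemigroupProperties
import Algebra.Properties.Semiring.Mult as SemiringMultiplication
import Relation.Binary.Reasoning.Setoid as SetoidReasoning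
import Algebra.Solver.Ring as RingSolver
open import Level using (_⊔_)
open import Data.Product using (Σ; proj₁; proj₂; _,_)

-- Integer coefficients let the solver prove identities that need cancellation, such as (x + y) - y ≈ x.
module IntegerRingSolver {c ℓ} (R : CommutativeRing c ℓ) where
  open CommutativeRing R
  open RingProperties ring
    using (-0#≈0#; -‿involutive; -‿+-comm; ⁻¹-anti-homo‿-; -1*x≈-x; //-rightDividesʳ)
  open CommutativeSemigroupProperties *-commutativeSemigroup using (interchange)
  open SemiringMultiplication semiring
  open SetoidReasoning setoid

  almostCommutativeRing : AlmostCommutativeRing c ℓ
  almostCommutativeRing = fromCommutativeRing R

  fromℤ : ℤ → Carrier
  fromℤ (ℤ.+ n)      = n × 1#
  fromℤ ℤ.-[1+ n ] = - (suc n × 1#)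

  private
    ×1-homo-∸ : ∀ {m n} → n ≤ m → (m ∸ n) × 1# ≈ m × 1# - n × 1#
    ×1-homo-∸ {m} {n} n≤m = begin
      (m ∸ n) × 1#                     ≈⟨ sym (//-rightDividesʳ (n × 1#) _) ⟩
      ((m ∸ n) × 1# + n × 1#) - n × 1#  ≈⟨ +-congʳ (sym (×-homo-+ 1# (m ∸ n) n)) ⟩
      ((m ∸ n ℕ.+ n) × 1#) - n × 1#     ≡⟨ ≡.cong (λ k → k × 1# - n × 1#) (ℕ.m∸n+n≡m n≤m) ⟩
      m × 1# - n × 1#                   ∎

    fromℤ-homo-- : ∀ i → fromℤ (ℤ.- i) ≈ - fromℤ i
    fromℤ-homo-- ℤ.-[1+ n ]  = sym (-‿involutive _)
    fromℤ-homo-- (ℤ.+ zero)  = sym -0#≈0#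
    fromℤ-homo-- (ℤ.+ suc n) = refl

    fromℤ-homo-⊖ : ∀ m n → fromℤ (m ℤ.⊖ n) ≈ m × 1# - n × 1#
    fromℤ-homo-⊖ m n with ℕ.≤-total n m
    ... | inj₁ n≤m = begin
      fromℤ (m ℤ.⊖ n)     ≡⟨ ≡.cong fromℤ (ℤ.⊖-≥ n≤m) ⟩
      (m ∸ n) × 1#    ≈⟨ ×1-homo-∸ n≤m ⟩
      m × 1# - n × 1# ∎
    ... | inj₂ m≤n = begin
      fromℤ (m ℤ.⊖ n)             ≡⟨ ≡.cong fromℤ (ℤ.⊖-≤ m≤n) ⟩
      fromℤ (ℤ.- ℤ.+ (n ∸ m))    ≈⟨ fromℤ-homo-- (ℤ.+ (n ∸ m)) ⟩
      - ((n ∸ m) × 1#)        ≈⟨ -‿cong (×1-homo-∸ m≤n) ⟩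
      - (n × 1# - m × 1#)     ≈⟨ ⁻¹-anti-homo‿- _ _ ⟩
      m × 1# - n × 1#         ∎

    fromℤ-homo-+ : ∀ i j → fromℤ (i ℤ.+ j) ≈ fromℤ i + fromℤ j
    fromℤ-homo-+ ℤ.-[1+ m ] ℤ.-[1+ n ] = begin
      - (suc (suc (m ℕ.+ n)) × 1#)          ≡⟨ ≡.cong (λ k → - (suc k × 1#)) (≡.sym (ℕ.+-suc m n)) ⟩
      - ((suc m ℕ.+ suc n) × 1#)            ≈⟨ -‿cong (×-homo-+ 1# (suc m) (suc n)) ⟩
      - (suc m × 1# + suc n × 1#)           ≈⟨ sym (-‿+-comm _ _) ⟩
      - (suc m × 1#) + - (suc n × 1#)       ∎
    fromℤ-homo-+ ℤ.-[1+ m ] (ℤ.+ n)    = trans (fromℤ-homo-⊖ n (suc m)) (+-comm _ _)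
    fromℤ-homo-+ (ℤ.+ m)    ℤ.-[1+ n ] = fromℤ-homo-⊖ m (suc n)
    fromℤ-homo-+ (ℤ.+ m)    (ℤ.+ n)    = ×-homo-+ 1# m n

    fromSign : Sign → Carrier
    fromSign Sign.+ = 1#
    fromSign Sign.- = - 1#

    fromSign-homo-* : ∀ s t → fromSign (s Sign.* t) ≈ fromSign s * fromSign t
    fromSign-homo-* Sign.+ t      = sym (*-identityˡ _)
    fromSign-homo-* Sign.- Sign.+ = sym (*-identityʳ _)
    fromSign-homo-* Sign.- Sign.- = sym (trans (-1*x≈-x _) (-‿involutive _))

    fromℤ-◃ : ∀ s n → fromℤ (s ℤ.◃ n) ≈ fromSign s * (n × 1#)
    fromℤ-◃ s      zero    = sym (zeroʳ _)
    fromℤ-◃ Sign.+ (suc n) = sym (*-identityˡ _)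
    fromℤ-◃ Sign.- (suc n) = sym (-1*x≈-x _)

    fromℤ-sign-abs : ∀ i → fromℤ i ≈ fromSign (ℤ.sign i) * (ℤ.∣ i ∣ × 1#)
    fromℤ-sign-abs i =
      trans (reflexive (≡.cong fromℤ (≡.sym (ℤ.◃-inverse i)))) (fromℤ-◃ (ℤ.sign i) ℤ.∣ i ∣)

    fromℤ-homo-* : ∀ i j → fromℤ (i ℤ.* j) ≈ fromℤ i * fromℤ j
    fromℤ-homo-* i j = begin
      fromℤ (ℤ.sign i Sign.* ℤ.sign j ℤ.◃ ℤ.∣ i ∣ ℕ.* ℤ.∣ j ∣)
        ≈⟨ fromℤ-◃ _ (ℤ.∣ i ∣ ℕ.* ℤ.∣ j ∣) ⟩
      fromSign (ℤ.sign i Sign.* ℤ.sign j) * ((ℤ.∣ i ∣ ℕ.* ℤ.∣ j ∣) × 1#)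
        ≈⟨ *-cong (fromSign-homo-* (ℤ.sign i) (ℤ.sign j)) (×1-homo-* ℤ.∣ i ∣ ℤ.∣ j ∣) ⟩
      (fromSign (ℤ.sign i) * fromSign (ℤ.sign j)) * (ℤ.∣ i ∣ × 1# * ℤ.∣ j ∣ × 1#)
        ≈⟨ interchange _ _ _ _ ⟩
      (fromSign (ℤ.sign i) * ℤ.∣ i ∣ × 1#) * (fromSign (ℤ.sign j) * ℤ.∣ j ∣ × 1#)
        ≈⟨ sym (*-cong (fromℤ-sign-abs i) (fromℤ-sign-abs j)) ⟩
      fromℤ i * fromℤ j ∎

    fromℤ-≈-if-≡ : ∀ i j → Maybe (fromℤ i ≈ fromℤ j)
    fromℤ-≈-if-≡ i j with i ℤ.≟ j
    ... | yes ≡.refl = just refl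
    ... | no _       = nothing

  ℤ⟶R : ℤ.+-*-rawRing -Raw-AlmostCommutative⟶ almostCommutativeRing
  ℤ⟶R = record
    { ⟦_⟧    = fromℤ
    ; +-homo = fromℤ-homo-+
    ; *-homo = fromℤ-homo-*
    ; -‿homo = fromℤ-homo--
    ; 0-homo = refl
    ; 1-homo = +-identityʳ 1#
    }

  open RingSolver ℤ.+-*-rawRing almostCommutativeRing ℤ⟶R fromℤ-≈-if-≡ public using (solve; _:=_; _:+_; _:*_; _:-_)

module PolynomialFunctions {c ℓ} (K : CharZeroField c ℓ) where
  open CharZeroField K
  open Theory K
  open RingProperties ring using (-1*x≈-x; x∙y⁻¹≈ε⇒x≈y; x≈y⇒x∙y⁻¹≈ε; [y-z]x≈yx-zx)
  open SemiringMultiplication semiring using (_×_; ×-homo-+; ×1-homo-*)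
  open IntegerRingSolver commutativeRing using (solve; _:=_; _:+_; _:*_; _:-_)
  open SetoidReasoning setoid

  fromℕ≡×1# : ∀ n → fromℕ n ≡ n × 1#
  fromℕ≡×1# zero    = ≡.refl
  fromℕ≡×1# (suc n) = ≡.cong (1# +_) (fromℕ≡×1# n)

  fromℕ-+ : ∀ m n → fromℕ (m ℕ.+ n) ≈ fromℕ m + fromℕ n
  fromℕ-+ m n
    rewrite fromℕ≡×1# (m ℕ.+ n) | fromℕ≡×1# m | fromℕ≡×1# n = ×-homo-+ 1# m n

  fromℕ-* : ∀ m n → fromℕ (m ℕ.* n) ≈ fromℕ m * fromℕ n
  fromℕ-* m n
    rewrite fromℕ≡×1# (m ℕ.* n) | fromℕ≡×1# m | fromℕ≡×1# n = ×1-homo-* m n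

  x*y≈0⇒y≈0 : ∀ {x y} → ¬ (x ≈ 0#) → x * y ≈ 0# → y ≈ 0#
  x*y≈0⇒y≈0 {x} {y} x≉0 xy≈0 = begin
    y                ≈⟨ sym (*-identityˡ y) ⟩
    1# * y           ≈⟨ *-congʳ (sym (trans (*-comm (x ⁻¹) x) (⁻¹-inverse x x≉0))) ⟩
    (x ⁻¹ * x) * y   ≈⟨ *-assoc (x ⁻¹) x y ⟩
    x ⁻¹ * (x * y)   ≈⟨ *-congˡ xy≈0 ⟩
    x ⁻¹ * 0#        ≈⟨ zeroʳ (x ⁻¹) ⟩
    0#               ∎

  x≉0∧y≉0⇒x*y≉0 : ∀ {x y} → ¬ (x ≈ 0#) → ¬ (y ≈ 0#) → ¬ (x * y ≈ 0#)
  x≉0∧y≉0⇒x*y≉0 x≉0 y≉0 xy≈0 = y≉0 (x*y≈0⇒y≈0 x≉0 xy≈0)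

  ⁻¹-unique : ∀ {x y} → ¬ (x ≈ 0#) → x * y ≈ 1# → y ≈ x ⁻¹
  ⁻¹-unique {x} {y} x≉0 xy≈1 = x∙y⁻¹≈ε⇒x≈y y (x ⁻¹) (x*y≈0⇒y≈0 x≉0 (begin
    x * (y - x ⁻¹)          ≈⟨ solve 3 (λ x y z → x :* (y :- z) := x :* y :- x :* z) refl x y (x ⁻¹) ⟩
    x * y - x * x ⁻¹        ≈⟨ x≈y⇒x∙y⁻¹≈ε (trans xy≈1 (sym (⁻¹-inverse x x≉0))) ⟩
    0#                      ∎))

  ⁻¹-≉0 : ∀ {x} → ¬ (x ≈ 0#) → ¬ (x ⁻¹ ≈ 0#)
  ⁻¹-≉0 {x} x≉0 x⁻¹≈0 = 0≉1 (begin
    0#           ≈⟨ sym (zeroʳ x) ⟩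
    x * 0#       ≈⟨ *-congˡ (sym x⁻¹≈0) ⟩
    x * x ⁻¹     ≈⟨ ⁻¹-inverse x x≉0 ⟩
    1#           ∎)

  fromℕ[n!]≉0 : ∀ n → ¬ (fromℕ (n !) ≈ 0#)
  fromℕ[n!]≉0 n with n ! | ℕ.1≤n! n
  ... | suc m | _ = charZero m

  invFact-≉0 : ∀ n → ¬ (invFact n ≈ 0#)
  invFact-≉0 n = ⁻¹-≉0 (fromℕ[n!]≉0 n)

  invFact-zero : invFact 0 ≈ 1#
  invFact-zero = sym (⁻¹-unique (charZero 0) (trans (*-identityʳ _) (+-identityʳ 1#)))

  invFact-suc : ∀ n → invFact (suc n) * fromℕ (suc n) ≈ invFact n
  invFact-suc n = ⁻¹-unique (fromℕ[n!]≉0 n) (begin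
    n!′ * (invFact (suc n) * n+1)  ≈⟨ solve 3 (λ a b c → a :* (b :* c) := (c :* a) :* b) refl _ _ _ ⟩
    (n+1 * n!′) * invFact (suc n)  ≈⟨ *-congʳ (sym (fromℕ-* (suc n) (n !))) ⟩
    fromℕ (suc n !) * invFact (suc n)  ≈⟨ ⁻¹-inverse _ (fromℕ[n!]≉0 (suc n)) ⟩
    1#                              ∎)
    where
    n+1 : Carrier
    n+1 = fromℕ (suc n)
    n!′ : Carrier
    n!′ = fromℕ (n !)

  Σ<-cong-< : ∀ n {f g : ℕ → Carrier} → (∀ i → i < n → f i ≈ g i) → Σ< n f ≈ Σ< n g
  Σ<-cong-< zero    f≈g = refl
  Σ<-cong-< (suc n) f≈g = +-cong (Σ<-cong-< n (λ i i<n → f≈g i (ℕ.m<n⇒m<1+n i<n))) (f≈g n ℕ.≤-refl)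

  Σ<-cong : ∀ n {f g : ℕ → Carrier} → (∀ i → f i ≈ g i) → Σ< n f ≈ Σ< n g
  Σ<-cong n f≈g = Σ<-cong-< n (λ i _ → f≈g i)

  Σ<-distrib-+ : ∀ n (f g : ℕ → Carrier) → Σ< n (λ i → f i + g i) ≈ Σ< n f + Σ< n g
  Σ<-distrib-+ zero    f g = sym (+-identityˡ 0#)
  Σ<-distrib-+ (suc n) f g = trans (+-congʳ (Σ<-distrib-+ n f g))
    (solve 4 (λ a b x y → (a :+ b) :+ (x :+ y) := (a :+ x) :+ (b :+ y)) refl _ _ _ _)

  Σ<-distribˡ : ∀ n a (f : ℕ → Carrier) → a * Σ< n f ≈ Σ< n (λ i → a * f i)
  Σ<-distribˡ zero    a f = zeroʳ a
  Σ<-distribˡ (suc n) a f = trans (distribˡ a _ _) (+-congʳ (Σ<-distribˡ n a f))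

  Σ<-distribʳ : ∀ n a (f : ℕ → Carrier) → Σ< n f * a ≈ Σ< n (λ i → f i * a)
  Σ<-distribʳ n a f =
    trans (*-comm _ a) (trans (Σ<-distribˡ n a f) (Σ<-cong n (λ i → *-comm a (f i))))

  Σ<-distrib-- : ∀ n (f g : ℕ → Carrier) → Σ< n (λ i → f i - g i) ≈ Σ< n f - Σ< n g
  Σ<-distrib-- n f g = begin
    Σ< n (λ i → f i - g i)              ≈⟨ Σ<-cong n (λ i → +-congˡ (sym (-1*x≈-x (g i)))) ⟩
    Σ< n (λ i → f i + - 1# * g i)       ≈⟨ Σ<-distrib-+ n f _ ⟩
    Σ< n f + Σ< n (λ i → - 1# * g i)    ≈⟨ +-congˡ (sym (Σ<-distribˡ n (- 1#) g)) ⟩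
    Σ< n f + - 1# * Σ< n g              ≈⟨ +-congˡ (-1*x≈-x _) ⟩
    Σ< n f - Σ< n g                     ∎

  Σ<-head : ∀ n (f : ℕ → Carrier) → Σ< (suc n) f ≈ f 0 + Σ< n (λ i → f (suc i))
  Σ<-head zero    f = trans (+-identityˡ _) (sym (+-identityʳ _))
  Σ<-head (suc n) f = trans (+-congʳ (Σ<-head n f)) (+-assoc _ _ _)

  Σ<-head-only : ∀ n (f : ℕ → Carrier) → (∀ i → f (suc i) ≈ 0#) → Σ< (suc n) f ≈ f 0
  Σ<-head-only n f tail≈0 =
    trans (Σ<-head n f) (trans (+-congˡ (Σ<-zero n _ (λ i _ → tail≈0 i))) (+-identityʳ _))

  Σ<-extend : ∀ {n m} (f : ℕ → Carrier) → n ≤ m → (∀ i → n ≤ i → f i ≈ 0#) → Σ< m f ≈ Σ< n f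
  Σ<-extend {n} {m} f n≤m f≈0 = ≡.subst (λ k → Σ< k f ≈ Σ< n f) (ℕ.m∸n+n≡m n≤m) (go (m ∸ n))
    where
    go : ∀ k → Σ< (k ℕ.+ n) f ≈ Σ< n f
    go zero    = refl
    go (suc k) = trans (+-cong (go k) (f≈0 (k ℕ.+ n) (ℕ.m≤n+m n k))) (+-identityʳ _)

  Σ<-reverse : ∀ n (f : ℕ → Carrier) → Σ< n f ≈ Σ< n (λ i → f (n ∸ suc i))
  Σ<-reverse zero    f = refl
  Σ<-reverse (suc n) f = begin
    Σ< n f + f n                       ≈⟨ +-comm _ _ ⟩
    f n + Σ< n f                       ≈⟨ +-congˡ (Σ<-reverse n f) ⟩
    f n + Σ< n (λ i → f (n ∸ suc i))   ≈⟨ sym (Σ<-head n (λ i → f (n ∸ i))) ⟩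
    Σ< (suc n) (λ i → f (n ∸ i))       ∎

  Σ<-triangle : ∀ n (h : ℕ → ℕ → Carrier) →
    Σ< n (λ i → Σ< (n ∸ i) (h i)) ≈ Σ< n (λ k → Σ< (suc k) (λ i → h i (k ∸ i)))
  Σ<-triangle zero    h = refl
  Σ<-triangle (suc n) h = begin
    Σ< (suc n) (λ i → Σ< (suc n ∸ i) (h i))
      ≈⟨ Σ<-cong-< (suc n) (λ i i≤n →
           reflexive (≡.cong (λ k → Σ< k (h i)) (ℕ.+-∸-assoc 1 (ℕ.≤-pred i≤n)))) ⟩
    Σ< (suc n) (λ i → Σ< (n ∸ i) (h i) + h i (n ∸ i))
      ≈⟨ Σ<-distrib-+ (suc n) _ _ ⟩
    Σ< (suc n) (λ i → Σ< (n ∸ i) (h i)) + Σ< (suc n) (λ i → h i (n ∸ i))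
      ≈⟨ +-congʳ (+-congˡ (reflexive (≡.cong (λ k → Σ< k (h n)) (ℕ.n∸n≡0 n)))) ⟩
    (Σ< n (λ i → Σ< (n ∸ i) (h i)) + 0#) + Σ< (suc n) (λ i → h i (n ∸ i))
      ≈⟨ +-congʳ (trans (+-identityʳ _) (Σ<-triangle n h)) ⟩
    Σ< n (λ k → Σ< (suc k) (λ i → h i (k ∸ i))) + Σ< (suc n) (λ i → h i (n ∸ i))
      ∎

  Σ<-square-antidiagonals : ∀ n (h : ℕ → ℕ → Carrier) → (∀ i j → n ≤ i ℕ.+ j → h i j ≈ 0#) →
    Σ< n (λ i → Σ< n (h i)) ≈ Σ< n (λ k → Σ< (suc k) (λ i → h i (k ∸ i)))
  Σ<-square-antidiagonals n h h≈0 = trans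
    (Σ<-cong n (λ i → Σ<-extend (h i) (ℕ.m∸n≤m n i)
      (λ j n∸i≤j → h≈0 i j (ℕ.≤-trans (ℕ.m≤n+m∸n n i) (ℕ.+-monoʳ-≤ i n∸i≤j)))))
    (Σ<-triangle n h)

  VanishesFrom : Poly → ℕ → Set ℓ
  VanishesFrom p n = ∀ i → n ≤ i → coeff p i ≈ 0#

  vanishesFrom-mono : ∀ p {m n} → m ≤ n → VanishesFrom p m → VanishesFrom p n
  vanishesFrom-mono p m≤n p≈0 i n≤i = p≈0 i (ℕ.≤-trans m≤n n≤i)

  vanishesFrom-⊔ˡ : ∀ p q → VanishesFrom p (bound p ℕ.⊔ bound q)
  vanishesFrom-⊔ˡ p q = vanishesFrom-mono p (ℕ.m≤m⊔n (bound p) (bound q)) (vanish p)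

  vanishesFrom-⊔ʳ : ∀ p q → VanishesFrom q (bound p ℕ.⊔ bound q)
  vanishesFrom-⊔ʳ p q = vanishesFrom-mono q (ℕ.m≤n⊔m (bound p) (bound q)) (vanish q)

  coeff--P : ∀ f g i → coeff (f -P g) i ≈ coeff f i - coeff g i
  coeff--P f g i = +-congˡ (-1*x≈-x _)

  ^-cong : ∀ {s t} k → s ≈ t → s ^ k ≈ t ^ k
  ^-cong zero    s≈t = refl
  ^-cong (suc k) s≈t = *-cong s≈t (^-cong k s≈t)

  ^-+ : ∀ t i j → t ^ (i ℕ.+ j) ≈ t ^ i * t ^ j
  ^-+ t zero    j = sym (*-identityˡ _)
  ^-+ t (suc i) j = trans (*-congˡ (^-+ t i j)) (sym (*-assoc _ _ _))

  eval< : ℕ → Carrier → Poly → Carrier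
  eval< n t p = Σ< n (λ k → coeff p k * t ^ k)

  eval≈eval< : ∀ {n} t p → VanishesFrom p n → eval t p ≈ eval< n t p
  eval≈eval< {n} t p p≈0 = trans
    (sym (Σ<-extend _ (ℕ.m≤m⊔n (bound p) n) (term≈0 (vanish p))))
    (Σ<-extend _ (ℕ.m≤n⊔m (bound p) n) (term≈0 p≈0))
    where
    term≈0 : ∀ {m} → VanishesFrom p m → ∀ k → m ≤ k → coeff p k * t ^ k ≈ 0#
    term≈0 p≈0 k m≤k = trans (*-congʳ (p≈0 k m≤k)) (zeroˡ _)

  eval-cong : ∀ t {p q} → p ≈P q → eval t p ≈ eval t q
  eval-cong t {p} {q} p≈q = begin
    eval t p     ≈⟨ eval≈eval< t p (vanishesFrom-⊔ˡ p q) ⟩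
    eval< B t p  ≈⟨ Σ<-cong B (λ k → *-congʳ (p≈q k)) ⟩
    eval< B t q  ≈⟨ sym (eval≈eval< t q (vanishesFrom-⊔ʳ p q)) ⟩
    eval t q     ∎
    where
    B : ℕ
    B = bound p ℕ.⊔ bound q

  eval-cong-point : ∀ {s t} p → s ≈ t → eval s p ≈ eval t p
  eval-cong-point p s≈t = Σ<-cong (bound p) (λ k → *-congˡ (^-cong k s≈t))

  eval-+ : ∀ t p q → eval t (p +P q) ≈ eval t p + eval t q
  eval-+ t p q = begin
    Σ< B (λ k → (coeff p k + coeff q k) * t ^ k)  ≈⟨ Σ<-cong B (λ k → distribʳ _ _ _) ⟩
    Σ< B (λ k → coeff p k * t ^ k + coeff q k * t ^ k)  ≈⟨ Σ<-distrib-+ B _ _ ⟩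
    eval< B t p + eval< B t q
      ≈⟨ sym (+-cong (eval≈eval< t p (vanishesFrom-⊔ˡ p q)) (eval≈eval< t q (vanishesFrom-⊔ʳ p q))) ⟩
    eval t p + eval t q  ∎
    where
    B : ℕ
    B = bound p ℕ.⊔ bound q

  eval-scale : ∀ t a p → eval t (scale a p) ≈ a * eval t p
  eval-scale t a p = trans (Σ<-cong (bound p) (λ k → *-assoc _ _ _)) (sym (Σ<-distribˡ (bound p) a _))

  eval-- : ∀ t p q → eval t (p -P q) ≈ eval t p - eval t q
  eval-- t p q = trans (eval-+ t p (negP q)) (+-congˡ (trans (eval-scale t (- 1#) q) (-1*x≈-x _)))

  eval-constP : ∀ t a → eval t (constP a) ≈ a
  eval-constP t a = trans (+-identityˡ _) (*-identityʳ a)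

  eval-xP : ∀ t → eval t xP ≈ t
  eval-xP t = trans (+-cong (trans (+-identityˡ _) (zeroˡ _)) (trans (*-identityˡ _) (*-identityʳ t)))
                    (+-identityˡ t)

  eval-* : ∀ t p q → eval t (p *P q) ≈ eval t p * eval t q
  eval-* t p q = begin
    Σ< B (λ k → Σ< (suc k) (λ i → coeff p i * coeff q (k ∸ i)) * t ^ k)
      ≈⟨ Σ<-cong B (λ k → trans (Σ<-distribʳ (suc k) (t ^ k) _)
                                 (Σ<-cong-< (suc k) (λ i i≤k → split-power k i (ℕ.≤-pred i≤k)))) ⟩
    Σ< B (λ k → Σ< (suc k) (λ i → h i (k ∸ i)))
      ≈⟨ sym (Σ<-square-antidiagonals B h h≈0) ⟩
    Σ< B (λ i → Σ< B (h i))
      ≈⟨ Σ<-cong B (λ i → sym (Σ<-distribˡ B _ _)) ⟩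
    Σ< B (λ i → (coeff p i * t ^ i) * eval< B t q)
      ≈⟨ sym (Σ<-distribʳ B _ _) ⟩
    eval< B t p * eval< B t q
      ≈⟨ sym (*-cong (eval≈eval< t p (vanishesFrom-mono p (ℕ.m≤m+n _ _) (vanish p)))
                     (eval≈eval< t q (vanishesFrom-mono q (ℕ.m≤n+m (bound q) (bound p)) (vanish q)))) ⟩
    eval t p * eval t q
      ∎
    where
    B : ℕ
    B = bound p ℕ.+ bound q
    h : ℕ → ℕ → Carrier
    h i j = (coeff p i * t ^ i) * (coeff q j * t ^ j)
    split-power : ∀ k i → i ≤ k → coeff p i * coeff q (k ∸ i) * t ^ k ≈ h i (k ∸ i)
    split-power k i i≤k = begin
      coeff p i * coeff q (k ∸ i) * t ^ k
        ≈⟨ *-congˡ (≡.subst (λ n → t ^ n ≈ t ^ i * t ^ (k ∸ i))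
                            (ℕ.m+[n∸m]≡n i≤k) (^-+ t i (k ∸ i))) ⟩
      coeff p i * coeff q (k ∸ i) * (t ^ i * t ^ (k ∸ i))
        ≈⟨ solve 4 (λ a b x y → a :* b :* (x :* y) := a :* x :* (b :* y)) refl _ _ _ _ ⟩
      h i (k ∸ i)
        ∎
    h≈0 : ∀ i j → B ≤ i ℕ.+ j → h i j ≈ 0#
    h≈0 i j B≤i+j with bound p ℕ.≤? i | bound q ℕ.≤? j
    ... | yes bp≤i | _        = trans (*-congʳ (trans (*-congʳ (vanish p i bp≤i)) (zeroˡ _))) (zeroˡ _)
    ... | no _     | yes bq≤j = trans (*-congˡ (trans (*-congʳ (vanish q j bq≤j)) (zeroˡ _))) (zeroʳ _)
    ... | no bp≰i  | no bq≰j  =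
      contradiction B≤i+j (ℕ.<⇒≱ (ℕ.+-mono-< (ℕ.≰⇒> bp≰i) (ℕ.≰⇒> bq≰j)))

  eval-powP : ∀ t q k → eval t (powP q k) ≈ eval t q ^ k
  eval-powP t q zero    = eval-constP t 1#
  eval-powP t q (suc k) = trans (eval-* t q (powP q k)) (*-congˡ (eval-powP t q k))

  eval-ΣP< : ∀ t n f → eval t (ΣP< n f) ≈ Σ< n (λ k → eval t (f k))
  eval-ΣP< t zero    f = refl
  eval-ΣP< t (suc n) f = trans (eval-+ t (ΣP< n f) (f n)) (+-congʳ (eval-ΣP< t n f))

  eval-comp : ∀ t p q → eval t (comp p q) ≈ eval (eval t q) p
  eval-comp t p q = trans (eval-ΣP< t (bound p) _)
    (Σ<-cong (bound p) (λ k → trans (eval-scale t (coeff p k) (powP q k)) (*-congˡ (eval-powP t q k))))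

  eval-E : ∀ t a f → eval t (E a f) ≈ eval (t + a) f
  eval-E t a f = trans (eval-comp t f _)
    (eval-cong-point f (trans (eval-+ t xP (constP a)) (+-cong (eval-xP t) (eval-constP t a))))

  fromℕ[n]-fromℕ[m]≉0 : ∀ {m n} → m < n → ¬ (fromℕ n - fromℕ m ≈ 0#)
  fromℕ[n]-fromℕ[m]≉0 {m} {n} m<n n-m≈0 = charZero d (begin
    fromℕ (suc d)                           ≈⟨ solve 2 (λ x y → x := (x :+ y) :- y) refl _ _ ⟩
    (fromℕ (suc d) + fromℕ m) - fromℕ m     ≈⟨ +-congʳ (sym (fromℕ-+ (suc d) m)) ⟩
    fromℕ (suc d ℕ.+ m) - fromℕ m           ≡⟨ ≡.cong (λ k → fromℕ k - fromℕ m) suc[d+m]≡n ⟩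
    fromℕ n - fromℕ m                       ≈⟨ n-m≈0 ⟩
    0#                                      ∎)
    where
    d : ℕ
    d = n ∸ suc m
    suc[d+m]≡n : suc d ℕ.+ m ≡ n
    suc[d+m]≡n = ≡.trans (≡.sym (ℕ.+-suc d m)) (ℕ.m∸n+n≡m m<n)

  -- Division by x - γ: with r k = Σ_{i ≤ b} p_{i+k} γ^i one has p_k = r_k - γ r_{k+1} and
  -- r_0 = p(γ), so the quotient has coefficients r_{k+1}.
  module SyntheticDivision (p : Poly) (b : ℕ) (p≈0 : VanishesFrom p (suc b)) (γ : Carrier) where

    r : ℕ → Carrier
    r k = Σ< (suc b) (λ i → coeff p (i ℕ.+ k) * γ ^ i)

    r-vanishes : ∀ k → suc b ≤ k → r k ≈ 0#
    r-vanishes k b<k = Σ<-zero (suc b) _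
      (λ i _ → trans (*-congʳ (p≈0 (i ℕ.+ k) (ℕ.≤-trans b<k (ℕ.m≤n+m k i)))) (zeroˡ _))

    quotient : Poly
    quotient = record { coeff = λ k → r (suc k) ; bound = b ; vanish = λ k b≤k → r-vanishes (suc k) (s≤s b≤k) }

    r-step : ∀ k → r k ≈ coeff p k + γ * r (suc k)
    r-step k = begin
      r k
        ≈⟨ Σ<-head b _ ⟩
      coeff p k * 1# + Σ< b (λ i → coeff p (suc i ℕ.+ k) * γ ^ suc i)
        ≈⟨ +-cong (*-identityʳ _)
                  (Σ<-cong b (λ i → solve 3 (λ a g x → a :* (g :* x) := g :* (a :* x)) refl _ γ _)) ⟩
      coeff p k + Σ< b (λ i → γ * (coeff p (suc i ℕ.+ k) * γ ^ i))
        ≈⟨ +-congˡ (Σ<-cong b (λ i →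
             reflexive (≡.cong (λ j → γ * (coeff p j * γ ^ i)) (≡.sym (ℕ.+-suc i k))))) ⟩
      coeff p k + Σ< b (λ i → γ * (coeff p (i ℕ.+ suc k) * γ ^ i))
        ≈⟨ +-congˡ (sym (trans (+-congˡ last≈0) (+-identityʳ _))) ⟩
      coeff p k + (Σ< b (λ i → γ * (coeff p (i ℕ.+ suc k) * γ ^ i)) + γ * (coeff p (b ℕ.+ suc k) * γ ^ b))
        ≈⟨ +-congˡ (sym (Σ<-distribˡ (suc b) γ _)) ⟩
      coeff p k + γ * r (suc k)
        ∎
      where
      last≈0 : γ * (coeff p (b ℕ.+ suc k) * γ ^ b) ≈ 0#
      last≈0 = trans (*-congˡ (trans (*-congʳ (p≈0 _
                     (ℕ.≤-trans (ℕ.m≤m+n (suc b) k) (ℕ.≤-reflexive (≡.sym (ℕ.+-suc b k))))))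
                                     (zeroˡ _))) (zeroʳ γ)

    coeff≈r-γr : ∀ k → coeff p k ≈ r k - γ * r (suc k)
    coeff≈r-γr k = trans (solve 2 (λ a x → a := (a :+ x) :- x) refl _ _) (+-congʳ (sym (r-step k)))

    r-zero : r 0 ≈ eval γ p
    r-zero = sym (trans (eval≈eval< γ p p≈0)
      (Σ<-cong (suc b) (λ i → reflexive (≡.cong (λ j → coeff p j * γ ^ i) (≡.sym (ℕ.+-identityʳ i))))))

    eval-factor : ∀ t → eval t p ≈ eval γ p + (t - γ) * eval t quotient
    eval-factor t = begin
      eval t p
        ≈⟨ eval≈eval< t p p≈0 ⟩
      Σ< (suc b) (λ k → coeff p k * t ^ k)
        ≈⟨ Σ<-cong (suc b) (λ k → trans (*-congʳ (coeff≈r-γr k)) ([y-z]x≈yx-zx _ _ _)) ⟩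
      Σ< (suc b) (λ k → r k * t ^ k - γ * r (suc k) * t ^ k)
        ≈⟨ Σ<-distrib-- (suc b) _ _ ⟩
      Σ< (suc b) (λ k → r k * t ^ k) - Σ< (suc b) (λ k → γ * r (suc k) * t ^ k)
        ≈⟨ +-cong (Σ<-head b _) (-‿cong (+-congˡ (trans (*-congʳ (*-congˡ (r-vanishes (suc b) ℕ.≤-refl)))
                                                       (trans (*-congʳ (zeroʳ γ)) (zeroˡ _))))) ⟩
      (r 0 * 1# + Σ< b (λ k → r (suc k) * (t * t ^ k))) - (Σ< b (λ k → γ * r (suc k) * t ^ k) + 0#)
        ≈⟨ +-cong (+-cong (*-identityʳ _)
                          (Σ<-cong b (λ k → solve 3 (λ a x y → a :* (x :* y) := x :* (a :* y)) refl _ t _)))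
                  (-‿cong (trans (+-identityʳ _) (Σ<-cong b (λ k → *-assoc γ _ _)))) ⟩
      (r 0 + Σ< b (λ k → t * (r (suc k) * t ^ k))) - Σ< b (λ k → γ * (r (suc k) * t ^ k))
        ≈⟨ +-cong (+-congˡ (sym (Σ<-distribˡ b t _))) (-‿cong (sym (Σ<-distribˡ b γ _))) ⟩
      (r 0 + t * eval t quotient) - γ * eval t quotient
        ≈⟨ solve 4 (λ a t g q → (a :+ t :* q) :- g :* q := a :+ (t :- g) :* q) refl _ t γ _ ⟩
      r 0 + (t - γ) * eval t quotient
        ≈⟨ +-congʳ r-zero ⟩
      eval γ p + (t - γ) * eval t quotient
        ∎

  vanishes-on-naturals⇒≈0 : ∀ b p i₀ → VanishesFrom p b →
    (∀ i → i₀ ≤ i → eval (fromℕ i) p ≈ 0#) → ∀ k → coeff p k ≈ 0#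
  vanishes-on-naturals⇒≈0 zero    p i₀ p≈0 roots k = p≈0 k z≤n
  vanishes-on-naturals⇒≈0 (suc b) p i₀ p≈0 roots k = begin
    coeff p k                ≈⟨ coeff≈r-γr k ⟩
    r k - γ * r (suc k)      ≈⟨ +-cong (r≈0 k) (-‿cong (trans (*-congˡ (r≈0 (suc k))) (zeroʳ γ))) ⟩
    0# - 0#                  ≈⟨ -‿inverseʳ 0# ⟩
    0#                       ∎
    where
    γ : Carrier
    γ = fromℕ i₀
    open SyntheticDivision p b p≈0 γ
    quotient-root : ∀ i → suc i₀ ≤ i → eval (fromℕ i) quotient ≈ 0#
    quotient-root i i₀<i = x*y≈0⇒y≈0 (fromℕ[n]-fromℕ[m]≉0 i₀<i) (begin
      (fromℕ i - γ) * eval (fromℕ i) quotient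
        ≈⟨ solve 2 (λ a x → x := (a :+ x) :- a) refl _ _ ⟩
      (eval γ p + (fromℕ i - γ) * eval (fromℕ i) quotient) - eval γ p
        ≈⟨ +-cong (trans (sym (eval-factor (fromℕ i))) (roots i (ℕ.<⇒≤ i₀<i)))
                  (-‿cong (roots i₀ ℕ.≤-refl)) ⟩
      0# - 0#
        ≈⟨ -‿inverseʳ 0# ⟩
      0#  ∎)
    r≈0 : ∀ k → r k ≈ 0#
    r≈0 zero    = trans r-zero (roots i₀ ℕ.≤-refl)
    r≈0 (suc k) = vanishes-on-naturals⇒≈0 b quotient (suc i₀) (vanish quotient) quotient-root k

  eval-injective : ∀ p q → (∀ t → eval t p ≈ eval t q) → p ≈P q
  eval-injective p q p≗q k = x∙y⁻¹≈ε⇒x≈y _ _ (trans (sym (coeff--P p q k))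
    (vanishes-on-naturals⇒≈0 _ (p -P q) 0 (vanish (p -P q))
      (λ i _ → trans (eval-- _ p q) (x≈y⇒x∙y⁻¹≈ε (p≗q _))) k))

  E-cong : ∀ a {f g} → f ≈P g → E a f ≈P E a g
  E-cong a {f} {g} f≈g = eval-injective (E a f) (E a g) (λ t →
    trans (eval-E t a f) (trans (eval-cong (t + a) {f} {g} f≈g) (sym (eval-E t a g))))

module PowerSeries {c ℓ} (K : CharZeroField c ℓ) where
  open CharZeroField K
  open Theory K
  open PolynomialFunctions K
  open IntegerRingSolver commutativeRing using (solve; _:=_; _:*_)
  open SetoidReasoning setoid

  D^ : ℕ → Op
  D^ k = DP ^O k

  coeff-ΣP< : ∀ n (f : ℕ → Poly) d → coeff (ΣP< n f) d ≈ Σ< n (λ k → coeff (f k) d)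
  coeff-ΣP< zero    f d = refl
  coeff-ΣP< (suc n) f d = +-congʳ (coeff-ΣP< n f d)

  DP-cong : ∀ {f g} → f ≈P g → DP f ≈P DP g
  DP-cong f≈g d = *-congˡ (f≈g (suc d))

  D^-cong : ∀ k {f g} → f ≈P g → D^ k f ≈P D^ k g
  D^-cong zero    f≈g = f≈g
  D^-cong (suc k) {f} {g} f≈g = DP-cong {D^ k f} {D^ k g} (D^-cong k f≈g)

  D^-+ : ∀ k f g → D^ k (f +P g) ≈P D^ k f +P D^ k g
  D^-+ zero    f g d = refl
  D^-+ (suc k) f g d =
    trans (DP-cong {D^ k (f +P g)} {D^ k f +P D^ k g} (D^-+ k f g) d) (distribˡ _ _ _)

  D^-scale : ∀ k a f → D^ k (scale a f) ≈P scale a (D^ k f)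
  D^-scale zero    a f d = refl
  D^-scale (suc k) a f d = trans (DP-cong {D^ k (scale a f)} {scale a (D^ k f)} (D^-scale k a f) d)
    (solve 3 (λ x a y → x :* (a :* y) := a :* (x :* y)) refl _ a _)

  D^-zeroP : ∀ k → D^ k zeroP ≈P zeroP
  D^-zeroP zero    d = refl
  D^-zeroP (suc k) d = trans (*-congˡ (D^-zeroP k (suc d))) (zeroʳ _)

  D^-ΣP< : ∀ k n (f : ℕ → Poly) → D^ k (ΣP< n f) ≈P ΣP< n (λ i → D^ k (f i))
  D^-ΣP< k zero    f = D^-zeroP k
  D^-ΣP< k (suc n) f d = trans (D^-+ k (ΣP< n f) (f n) d) (+-congʳ (D^-ΣP< k n f d))

  coeff-D^-vanishes : ∀ k {f L} → VanishesFrom f L → ∀ d → L ≤ d ℕ.+ k → coeff (D^ k f) d ≈ 0#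
  coeff-D^-vanishes zero    f≈0 d L≤d+k = f≈0 d (ℕ.≤-trans L≤d+k (ℕ.≤-reflexive (ℕ.+-identityʳ d)))
  coeff-D^-vanishes (suc k) f≈0 d L≤d+k =
    trans (*-congˡ (coeff-D^-vanishes k f≈0 (suc d) (ℕ.≤-trans L≤d+k (ℕ.≤-reflexive (ℕ.+-suc d k)))))
          (zeroʳ _)

  DP-D^-comm : ∀ k f → DP (D^ k f) ≈P D^ k (DP f)
  DP-D^-comm zero    f d = refl
  DP-D^-comm (suc k) f = DP-cong {DP (D^ k f)} {D^ k (DP f)} (DP-D^-comm k f)

  D^-D^ : ∀ i j f → D^ i (D^ j f) ≈P D^ (i ℕ.+ j) f
  D^-D^ zero    j f d = refl
  D^-D^ (suc i) j f = DP-cong {D^ i (D^ j f)} {D^ (i ℕ.+ j) f} (D^-D^ i j f)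

  applySeries< : ℕ → Series → Poly → Poly
  applySeries< n A f = ΣP< n (λ k → scale (A k) (D^ k f))

  coeff-applySeries< : ∀ n A f d → coeff (applySeries< n A f) d ≈ Σ< n (λ k → A k * coeff (D^ k f) d)
  coeff-applySeries< n A f d = coeff-ΣP< n _ d

  applySeries≈applySeries< : ∀ {L} A f → VanishesFrom f L → applySeries A f ≈P applySeries< L A f
  applySeries≈applySeries< {L} A f f≈0 d = begin
    coeff (applySeries A f) d
      ≈⟨ coeff-applySeries< (bound f) A f d ⟩
    Σ< (bound f) term
      ≈⟨ sym (Σ<-extend term (ℕ.m≤m⊔n (bound f) L) (term≈0 (vanish f))) ⟩
    Σ< (bound f ℕ.⊔ L) term
      ≈⟨ Σ<-extend term (ℕ.m≤n⊔m (bound f) L) (term≈0 f≈0) ⟩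
    Σ< L term
      ≈⟨ sym (coeff-applySeries< L A f d) ⟩
    coeff (applySeries< L A f) d
      ∎
    where
    term : ℕ → Carrier
    term k = A k * coeff (D^ k f) d
    term≈0 : ∀ {M} → VanishesFrom f M → ∀ k → M ≤ k → term k ≈ 0#
    term≈0 f≈0 k M≤k =
      trans (*-congˡ (coeff-D^-vanishes k f≈0 d (ℕ.≤-trans M≤k (ℕ.m≤n+m k d)))) (zeroʳ _)

  applySeries-cong : ∀ A {f g} → f ≈P g → applySeries A f ≈P applySeries A g
  applySeries-cong A {f} {g} f≈g d = begin
    coeff (applySeries A f) d                  ≈⟨ applySeries≈applySeries< A f (vanishesFrom-⊔ˡ f g) d ⟩
    coeff (applySeries< B A f) d               ≈⟨ coeff-applySeries< B A f d ⟩
    Σ< B (λ k → A k * coeff (D^ k f) d)        ≈⟨ Σ<-cong B (λ k → *-congˡ (D^-cong k f≈g d)) ⟩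
    Σ< B (λ k → A k * coeff (D^ k g) d)        ≈⟨ sym (coeff-applySeries< B A g d) ⟩
    coeff (applySeries< B A g) d               ≈⟨ sym (applySeries≈applySeries< A g (vanishesFrom-⊔ʳ f g) d) ⟩
    coeff (applySeries A g) d                  ∎
    where
    B : ℕ
    B = bound f ℕ.⊔ bound g

  applySeries-cong-series : ∀ {A B} f → (∀ k → A k ≈ B k) → applySeries A f ≈P applySeries B f
  applySeries-cong-series {A} {B} f A≈B d = begin
    coeff (applySeries A f) d                     ≈⟨ coeff-applySeries< (bound f) A f d ⟩
    Σ< (bound f) (λ k → A k * coeff (D^ k f) d)   ≈⟨ Σ<-cong (bound f) (λ k → *-congʳ (A≈B k)) ⟩
    Σ< (bound f) (λ k → B k * coeff (D^ k f) d)   ≈⟨ sym (coeff-applySeries< (bound f) B f d) ⟩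
    coeff (applySeries B f) d                     ∎

  applySeries-scale : ∀ A a f → applySeries A (scale a f) ≈P scale a (applySeries A f)
  applySeries-scale A a f d = begin
    coeff (applySeries A (scale a f)) d
      ≈⟨ coeff-applySeries< (bound f) A (scale a f) d ⟩
    Σ< (bound f) (λ k → A k * coeff (D^ k (scale a f)) d)
      ≈⟨ Σ<-cong (bound f) (λ k → trans (*-congˡ (D^-scale k a f d))
                                        (solve 3 (λ x a y → x :* (a :* y) := a :* (x :* y)) refl _ a _)) ⟩
    Σ< (bound f) (λ k → a * (A k * coeff (D^ k f) d))
      ≈⟨ sym (Σ<-distribˡ (bound f) a _) ⟩
    a * Σ< (bound f) (λ k → A k * coeff (D^ k f) d)
      ≈⟨ *-congˡ (sym (coeff-applySeries< (bound f) A f d)) ⟩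
    coeff (scale a (applySeries A f)) d
      ∎

  applySeries-oneS : ∀ f → applySeries oneS f ≈P f
  applySeries-oneS f d with bound f | vanish f
  ... | zero  | f≈0 = sym (f≈0 d z≤n)
  ... | suc m | _   = trans (coeff-ΣP< (suc m) _ d) (trans (Σ<-head-only m _ (λ i → zeroˡ _)) (*-identityˡ _))

  DP-applySeries : ∀ A f → DP (applySeries A f) ≈P applySeries A (DP f)
  DP-applySeries A f d = begin
    fromℕ (suc d) * coeff (applySeries A f) (suc d)
      ≈⟨ *-congˡ (coeff-applySeries< (bound f) A f (suc d)) ⟩
    fromℕ (suc d) * Σ< (bound f) (λ k → A k * coeff (D^ k f) (suc d))
      ≈⟨ Σ<-distribˡ (bound f) _ _ ⟩
    Σ< (bound f) (λ k → fromℕ (suc d) * (A k * coeff (D^ k f) (suc d)))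
      ≈⟨ Σ<-cong (bound f) (λ k → trans (solve 3 (λ x a y → x :* (a :* y) := a :* (x :* y)) refl _ _ _)
                                        (*-congˡ (DP-D^-comm k f d))) ⟩
    Σ< (bound f) (λ k → A k * coeff (D^ k (DP f)) d)
      ≈⟨ sym (coeff-applySeries< (bound f) A (DP f) d) ⟩
    coeff (applySeries A (DP f)) d
      ∎

  ⋆-comm : ∀ A B k → (A ⋆ B) k ≈ (B ⋆ A) k
  ⋆-comm A B k = trans (Σ<-reverse (suc k) _) (Σ<-cong-< (suc k) (λ i i≤k → trans (*-comm _ _)
    (*-congʳ (reflexive (≡.cong B (ℕ.m∸[m∸n]≡n (ℕ.≤-pred i≤k)))))))

  applySeries-⋆ : ∀ A B f → applySeries A (applySeries B f) ≈P applySeries (A ⋆ B) f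
  applySeries-⋆ A B f d = begin
    coeff (applySeries A g) d
      ≈⟨ applySeries≈applySeries< A g g≈0 d ⟩
    coeff (applySeries< n A g) d
      ≈⟨ coeff-applySeries< n A g d ⟩
    Σ< n (λ i → A i * coeff (D^ i g) d)
      ≈⟨ Σ<-cong n (λ i → *-congˡ (coeff-D^-g i)) ⟩
    Σ< n (λ i → A i * Σ< n (λ j → B j * f⁽ i ℕ.+ j ⁾))
      ≈⟨ Σ<-cong n (λ i → Σ<-distribˡ n (A i) _) ⟩
    Σ< n (λ i → Σ< n (λ j → A i * (B j * f⁽ i ℕ.+ j ⁾)))
      ≈⟨ Σ<-square-antidiagonals n _ (λ i j n≤i+j → trans (*-congˡ (trans (*-congˡ
           (coeff-D^-vanishes (i ℕ.+ j) (vanish f) d (ℕ.≤-trans n≤i+j (ℕ.m≤n+m _ d)))) (zeroʳ _))) (zeroʳ _)) ⟩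
    Σ< n (λ k → Σ< (suc k) (λ i → A i * (B (k ∸ i) * f⁽ i ℕ.+ (k ∸ i) ⁾)))
      ≈⟨ Σ<-cong n (λ k → Σ<-cong-< (suc k) (λ i i≤k → trans
           (*-congˡ (*-congˡ (reflexive (≡.cong f⁽_⁾ (ℕ.m+[n∸m]≡n (ℕ.≤-pred i≤k)))))) (sym (*-assoc _ _ _)))) ⟩
    Σ< n (λ k → Σ< (suc k) (λ i → A i * B (k ∸ i) * f⁽ k ⁾))
      ≈⟨ Σ<-cong n (λ k → sym (Σ<-distribʳ (suc k) (f⁽ k ⁾) _)) ⟩
    Σ< n (λ k → (A ⋆ B) k * f⁽ k ⁾)
      ≈⟨ sym (coeff-applySeries< n (A ⋆ B) f d) ⟩
    coeff (applySeries (A ⋆ B) f) d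
      ∎
    where
    n : ℕ
    n = bound f
    g : Poly
    g = applySeries B f
    f⁽_⁾ : ℕ → Carrier
    f⁽ m ⁾ = coeff (D^ m f) d
    g≈0 : VanishesFrom g n
    g≈0 d′ n≤d′ = trans (coeff-applySeries< n B f d′) (Σ<-zero n _ (λ j _ →
      trans (*-congˡ (coeff-D^-vanishes j (vanish f) d′ (ℕ.≤-trans n≤d′ (ℕ.m≤m+n d′ j)))) (zeroʳ _)))
    coeff-D^-g : ∀ i → coeff (D^ i g) d ≈ Σ< n (λ j → B j * f⁽ i ℕ.+ j ⁾)
    coeff-D^-g i = begin
      coeff (D^ i g) d                                        ≈⟨ D^-ΣP< i n _ d ⟩
      coeff (ΣP< n (λ j → D^ i (scale (B j) (D^ j f)))) d     ≈⟨ coeff-ΣP< n _ d ⟩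
      Σ< n (λ j → coeff (D^ i (scale (B j) (D^ j f))) d)      ≈⟨ Σ<-cong n (λ j → trans (D^-scale i (B j) (D^ j f) d)
                                                                                       (*-congˡ (D^-D^ i j f d))) ⟩
      Σ< n (λ j → B j * f⁽ i ℕ.+ j ⁾)                         ∎

  applySeries-comm : ∀ A B f → applySeries A (applySeries B f) ≈P applySeries B (applySeries A f)
  applySeries-comm A B f d = trans (applySeries-⋆ A B f d)
    (trans (applySeries-cong-series f (⋆-comm A B) d) (sym (applySeries-⋆ B A f d)))

module LinearMaps {c ℓ} (K : CharZeroField c ℓ) where
  open CharZeroField K
  open Theory K
  open RingProperties ring using (-1*x≈-x)
  open PolynomialFunctions K
  open IntegerRingSolver commutativeRing using (solve; _:=_; _:+_; _:*_; _:-_)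
  open SetoidReasoning setoid

  module _ {T U : Op} (T-linear : IsLinear T) (U-linear : IsLinear U) where
    private
      module T = IsLinear T-linear
      module U = IsLinear U-linear

    IsLinear-∘ : IsLinear (T ∘O U)
    IsLinear-∘ = record
      { cong        = λ f g f≈g → T.cong (U f) (U g) (U.cong f g f≈g)
      ; additive    = λ f g d → trans (T.cong (U (f +P g)) (U f +P U g) (U.additive f g) d)
                                      (T.additive (U f) (U g) d)
      ; homogeneous = λ a f d → trans (T.cong (U (scale a f)) (scale a (U f)) (U.homogeneous a f) d)
                                      (T.homogeneous a (U f) d)
      }

  IsLinear-^O : ∀ {T} → IsLinear T → ∀ m → IsLinear (T ^O m)
  IsLinear-^O T-linear zero    = record
    { cong = λ _ _ f≈g → f≈g ; additive = λ _ _ _ → refl ; homogeneous = λ _ _ _ → refl }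
  IsLinear-^O T-linear (suc m) = IsLinear-∘ T-linear (IsLinear-^O T-linear m)

  module _ {T : Op} (T-linear : IsLinear T) where
    open IsLinear T-linear

    IsLinear-zeroP : ∀ f → (∀ i → coeff f i ≈ 0#) → T f ≈P zeroP
    IsLinear-zeroP f f≈0 d = begin
      coeff (T f) d               ≈⟨ cong f (scale 0# f) (λ i → trans (f≈0 i) (sym (zeroˡ _))) d ⟩
      coeff (T (scale 0# f)) d    ≈⟨ homogeneous 0# f d ⟩
      0# * coeff (T f) d          ≈⟨ zeroˡ _ ⟩
      0#                          ∎

    IsLinear--P : ∀ f g → T (f -P g) ≈P T f -P T g
    IsLinear--P f g d = trans (additive f (negP g) d) (+-congˡ (homogeneous (- 1#) g d))

  E-isLinear : ∀ a → IsLinear (E a)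
  E-isLinear a = record
    { cong        = λ f g → E-cong a {f} {g}
    ; additive    = λ f g → eval-injective (E a (f +P g)) (E a f +P E a g) (λ t → begin
        eval t (E a (f +P g))               ≈⟨ eval-E t a (f +P g) ⟩
        eval (t + a) (f +P g)               ≈⟨ eval-+ (t + a) f g ⟩
        eval (t + a) f + eval (t + a) g     ≈⟨ sym (+-cong (eval-E t a f) (eval-E t a g)) ⟩
        eval t (E a f) + eval t (E a g)     ≈⟨ sym (eval-+ t (E a f) (E a g)) ⟩
        eval t (E a f +P E a g)             ∎)
    ; homogeneous = λ α f → eval-injective (E a (scale α f)) (scale α (E a f)) (λ t → begin
        eval t (E a (scale α f))            ≈⟨ eval-E t a (scale α f) ⟩
        eval (t + a) (scale α f)            ≈⟨ eval-scale (t + a) α f ⟩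
        α * eval (t + a) f                  ≈⟨ sym (*-congˡ (eval-E t a f)) ⟩
        α * eval t (E a f)                  ≈⟨ sym (eval-scale t α (E a f)) ⟩
        eval t (scale α (E a f))            ∎)
    }

  record IsLinearFunctional (L : Poly → Carrier) : Set (c ⊔ ℓ) where
    field
      cong        : ∀ f g → f ≈P g → L f ≈ L g
      additive    : ∀ f g → L (f +P g) ≈ L f + L g
      homogeneous : ∀ a f → L (scale a f) ≈ a * L f

    zero-at-≈0 : ∀ f → (∀ i → coeff f i ≈ 0#) → L f ≈ 0#
    zero-at-≈0 f f≈0 = begin
      L f             ≈⟨ cong f (scale 0# f) (λ i → trans (f≈0 i) (sym (zeroˡ _))) ⟩
      L (scale 0# f)  ≈⟨ homogeneous 0# f ⟩
      0# * L f        ≈⟨ zeroˡ _ ⟩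
      0#              ∎

  eval∘-isLinearFunctional : ∀ {T} → IsLinear T → ∀ t → IsLinearFunctional (λ f → eval t (T f))
  eval∘-isLinearFunctional {T} T-linear t = record
    { cong        = λ f g f≈g → eval-cong t {T f} {T g} (T.cong f g f≈g)
    ; additive    = λ f g → trans (eval-cong t {T (f +P g)} {T f +P T g} (T.additive f g))
                                  (eval-+ t (T f) (T g))
    ; homogeneous = λ a f → trans (eval-cong t {T (scale a f)} {scale a (T f)} (T.homogeneous a f))
                                  (eval-scale t a (T f))
    }
    where module T = IsLinear T-linear

  weightedΣ<-isLinearFunctional : ∀ n (w : ℕ → Carrier) {L : ℕ → Poly → Carrier} →
    (∀ m → IsLinearFunctional (L m)) → IsLinearFunctional (λ f → Σ< n (λ m → w m * L m f))
  weightedΣ<-isLinearFunctional n w {L} L-linear = record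
    { cong        = λ f g f≈g → Σ<-cong n (λ m → *-congˡ (Lₘ.cong m f g f≈g))
    ; additive    = λ f g → trans (Σ<-cong n (λ m → trans (*-congˡ (Lₘ.additive m f g)) (distribˡ _ _ _)))
                                  (Σ<-distrib-+ n _ _)
    ; homogeneous = λ a f → trans (Σ<-cong n (λ m → trans (*-congˡ (Lₘ.homogeneous m a f))
                                     (solve 3 (λ w a x → w :* (a :* x) := a :* (w :* x)) refl _ a _)))
                                  (sym (Σ<-distribˡ n a _))
    }
    where module Lₘ m = IsLinearFunctional (L-linear m)

  linearFunctionals-agree-on-basis : ∀ {L₁ L₂} → IsLinearFunctional L₁ → IsLinearFunctional L₂ →
    (b : ℕ → Poly) → (∀ k → HasDegree (b k) k) →
    ∀ n → (∀ k → k < n → L₁ (b k) ≈ L₂ (b k)) → ∀ f → VanishesFrom f n → L₁ f ≈ L₂ f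
  linearFunctionals-agree-on-basis {L₁} {L₂} L₁-linear L₂-linear b b-degree zero agree f f≈0 =
    trans (L₁.zero-at-≈0 f (λ i → f≈0 i z≤n)) (sym (L₂.zero-at-≈0 f (λ i → f≈0 i z≤n)))
    where
    module L₁ = IsLinearFunctional L₁-linear
    module L₂ = IsLinearFunctional L₂-linear
  linearFunctionals-agree-on-basis {L₁} {L₂} L₁-linear L₂-linear b b-degree (suc n) agree f f≈0 = begin
    L₁ f                          ≈⟨ split L₁-linear ⟩
    α * L₁ (b n) + L₁ h           ≈⟨ +-cong (*-congˡ (agree n ℕ.≤-refl)) L₁h≈L₂h ⟩
    α * L₂ (b n) + L₂ h           ≈⟨ sym (split L₂-linear) ⟩
    L₂ f                          ∎
    where
    lead : Carrier
    lead = coeff (b n) n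
    α : Carrier
    α = coeff f n * lead ⁻¹
    h : Poly
    h = f -P scale α (b n)
    α*lead≈coeff : α * lead ≈ coeff f n
    α*lead≈coeff = trans (*-assoc _ _ _)
      (trans (*-congˡ (trans (*-comm _ _) (⁻¹-inverse lead (proj₁ (b-degree n))))) (*-identityʳ _))
    h≈0 : VanishesFrom h n
    h≈0 i n≤i with ℕ.m≤n⇒m<n∨m≡n n≤i
    ... | inj₂ ≡.refl = trans (+-congˡ (-1*x≈-x _)) (trans (+-congʳ (sym α*lead≈coeff)) (-‿inverseʳ _))
    ... | inj₁ n<i    = trans (+-cong (f≈0 i n<i) (trans (*-congˡ (trans (*-congˡ (proj₂ (b-degree n) i n<i))
                                (zeroʳ α))) (zeroʳ _))) (+-identityʳ 0#)
    L₁h≈L₂h : L₁ h ≈ L₂ h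
    L₁h≈L₂h = linearFunctionals-agree-on-basis L₁-linear L₂-linear b b-degree n
      (λ k k<n → agree k (ℕ.m<n⇒m<1+n k<n)) h h≈0
    split : ∀ {L} → IsLinearFunctional L → L f ≈ α * L (b n) + L h
    split {L} L-linear = begin
      L f                         ≈⟨ cong f (scale α (b n) +P h)
                                       (λ i → trans (solve 2 (λ y x → x := y :+ (x :- y)) refl _ _)
                                                    (+-congˡ (+-congˡ (sym (-1*x≈-x _))))) ⟩
      L (scale α (b n) +P h)      ≈⟨ additive _ h ⟩
      L (scale α (b n)) + L h     ≈⟨ +-congʳ (homogeneous α (b n)) ⟩
      α * L (b n) + L h           ∎
      where open IsLinearFunctional L-linear

module DeltaOperators {c ℓ} (K : CharZeroField c ℓ) where
  open CharZeroField K
  open Theory K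
  open RingProperties ring using (x∙y⁻¹≈ε⇒x≈y; x≈y⇒x∙y⁻¹≈ε)
  open PolynomialFunctions K
  open PowerSeries K
  open LinearMaps K
  open SetoidReasoning setoid

  module DeltaOperator (Q : Op) (Q-linear : IsLinear Q) (Q-shift : ShiftInvariant Q)
                       (P : Series) (Q-form : IsDeltaForm Q P)
                       (φseq : ℕ → Poly) (φ : Op) (umbral : IsUmbral Q φseq φ) where

    open IsLinear Q-linear using (additive; homogeneous) renaming (cong to Q-cong)
    open IsUmbral umbral using (degree; zeroth; atZero; lower)

    Q≈DP∘P : ∀ f → Q f ≈P DP (applySeries P f)
    Q≈DP∘P = proj₂ Q-form

    Q-constP : ∀ a → Q (constP a) ≈P zeroP
    Q-constP a d = trans (Q≈DP∘P (constP a) d) (trans (*-congˡ (trans (+-identityˡ _) (zeroʳ _))) (zeroʳ _))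

    Q-applySeries : ∀ A g → Q (applySeries A g) ≈P applySeries A (Q g)
    Q-applySeries A g d = begin
      coeff (Q (applySeries A g)) d                  ≈⟨ Q≈DP∘P (applySeries A g) d ⟩
      coeff (DP (applySeries P (applySeries A g))) d
        ≈⟨ DP-cong {applySeries P (applySeries A g)} {applySeries A (applySeries P g)} (applySeries-comm P A g) d ⟩
      coeff (DP (applySeries A (applySeries P g))) d ≈⟨ DP-applySeries A (applySeries P g) d ⟩
      coeff (applySeries A (DP (applySeries P g))) d
        ≈⟨ applySeries-cong A {DP (applySeries P g)} {Q g} (λ d′ → sym (Q≈DP∘P g d′)) d ⟩
      coeff (applySeries A (Q g)) d                  ∎

    coeff-Q-top : ∀ {g} b → VanishesFrom g (suc (suc b)) →
      coeff (Q g) b ≈ fromℕ (suc b) * (P 0 * coeff g (suc b))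
    coeff-Q-top {g} b g≈0 = trans (Q≈DP∘P g b) (*-congˡ (begin
      coeff (applySeries P g) (suc b)
        ≈⟨ applySeries≈applySeries< P g g≈0 (suc b) ⟩
      coeff (applySeries< (suc (suc b)) P g) (suc b)
        ≈⟨ coeff-applySeries< (suc (suc b)) P g (suc b) ⟩
      Σ< (suc (suc b)) (λ k → P k * coeff (D^ k g) (suc b))
        ≈⟨ Σ<-head-only (suc b) _ (λ i → trans (*-congˡ (coeff-D^-vanishes (suc i) g≈0 (suc b)
             (s≤s (ℕ.≤-trans (ℕ.m≤m+n (suc b) i) (ℕ.≤-reflexive (≡.sym (ℕ.+-suc b i))))))) (zeroʳ _)) ⟩
      P 0 * coeff g (suc b)
        ∎))

    Q≈0⇒vanishesFrom-1 : ∀ {g} → Q g ≈P zeroP → ∀ b → VanishesFrom g (suc b) → VanishesFrom g 1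
    Q≈0⇒vanishesFrom-1 Qg≈0 zero    g≈0 = g≈0
    Q≈0⇒vanishesFrom-1 {g} Qg≈0 (suc b) g≈0 = Q≈0⇒vanishesFrom-1 Qg≈0 b g≈0′
      where
      top≈0 : coeff g (suc b) ≈ 0#
      top≈0 = x*y≈0⇒y≈0 (proj₁ Q-form)
                (x*y≈0⇒y≈0 (charZero b) (trans (sym (coeff-Q-top b g≈0)) (Qg≈0 b)))
      g≈0′ : VanishesFrom g (suc b)
      g≈0′ i b<i with ℕ.m≤n⇒m<n∨m≡n b<i
      ... | inj₁ b+1<i  = g≈0 i b+1<i
      ... | inj₂ ≡.refl = top≈0

    Q∧eval0-injective : ∀ f g → Q f ≈P Q g → eval 0# f ≈ eval 0# g → f ≈P g
    Q∧eval0-injective f g Qf≈Qg f0≈g0 i = x∙y⁻¹≈ε⇒x≈y _ _ (trans (sym (coeff--P f g i)) (h≈0 i))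
      where
      h : Poly
      h = f -P g
      Qh≈0 : Q h ≈P zeroP
      Qh≈0 d = trans (IsLinear--P Q-linear f g d) (trans (coeff--P (Q f) (Q g) d) (x≈y⇒x∙y⁻¹≈ε (Qf≈Qg d)))
      h-linear : VanishesFrom h 1
      h-linear = Q≈0⇒vanishesFrom-1 Qh≈0 (bound h) (vanishesFrom-mono h (ℕ.n≤1+n _) (vanish h))
      h≈0 : ∀ i → coeff h i ≈ 0#
      h≈0 zero    = begin
        coeff h 0      ≈⟨ sym (trans (eval≈eval< 0# h h-linear) (trans (+-identityˡ _) (*-identityʳ _))) ⟩
        eval 0# h      ≈⟨ eval-- 0# f g ⟩
        eval 0# f - eval 0# g ≈⟨ x≈y⇒x∙y⁻¹≈ε f0≈g0 ⟩
        0#             ∎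
      h≈0 (suc i) = h-linear (suc i) (s≤s z≤n)

    φ̂ : ℕ → Poly
    φ̂ n = scale (invFact n) (φseq n)

    φ̂-hasDegree : ∀ n → HasDegree (φ̂ n) n
    φ̂-hasDegree n = x≉0∧y≉0⇒x*y≉0 (invFact-≉0 n) (proj₁ (degree n))
                  , λ m n<m → trans (*-congˡ (proj₂ (degree n) m n<m)) (zeroʳ _)

    Q-φ̂-suc : ∀ n → Q (φ̂ (suc n)) ≈P φ̂ n
    Q-φ̂-suc n d = begin
      coeff (Q (φ̂ (suc n))) d                                 ≈⟨ homogeneous (invFact (suc n)) (φseq (suc n)) d ⟩
      invFact (suc n) * coeff (Q (φseq (suc n))) d            ≈⟨ *-congˡ (lower n d) ⟩
      invFact (suc n) * (fromℕ (suc n) * coeff (φseq n) d)    ≈⟨ sym (*-assoc _ _ _) ⟩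
      (invFact (suc n) * fromℕ (suc n)) * coeff (φseq n) d    ≈⟨ *-congʳ (invFact-suc n) ⟩
      coeff (φ̂ n) d                                           ∎

    Q-φ̂-zero : Q (φ̂ 0) ≈P zeroP
    Q-φ̂-zero d = begin
      coeff (Q (φ̂ 0)) d                    ≈⟨ homogeneous (invFact 0) (φseq 0) d ⟩
      invFact 0 * coeff (Q (φseq 0)) d     ≈⟨ *-congˡ (trans (Q-cong (φseq 0) (constP 1#) zeroth d) (Q-constP 1# d)) ⟩
      invFact 0 * 0#                       ≈⟨ zeroʳ _ ⟩
      0#                                   ∎

    Q-φ̂-∸ : ∀ {j n} → j ≤ n → Q (φ̂ (suc n ∸ j)) ≈P φ̂ (n ∸ j)
    Q-φ̂-∸ {j} {n} j≤n rewrite ℕ.+-∸-assoc 1 j≤n = Q-φ̂-suc (n ∸ j)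

    eval-φ̂-zero : ∀ t → eval t (φ̂ 0) ≈ 1#
    eval-φ̂-zero t = begin
      eval t (φ̂ 0)                 ≈⟨ eval-scale t _ (φseq 0) ⟩
      invFact 0 * eval t (φseq 0)  ≈⟨ *-cong invFact-zero (eval-cong t {φseq 0} {constP 1#} zeroth) ⟩
      1# * eval t (constP 1#)      ≈⟨ trans (*-identityˡ _) (eval-constP t 1#) ⟩
      1#                           ∎

    eval-0-φ̂-suc : ∀ n → eval 0# (φ̂ (suc n)) ≈ 0#
    eval-0-φ̂-suc n = trans (eval-scale 0# _ (φseq (suc n))) (trans (*-congˡ (atZero n)) (zeroʳ _))

    Q^-φ̂ : ∀ m k → m ≤ k → (Q ^O m) (φ̂ k) ≈P φ̂ (k ∸ m)
    Q^-φ̂ zero    k       _         = λ _ → refl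
    Q^-φ̂ (suc m) (suc k) (s≤s m≤k) d =
      trans (Q-cong _ (φ̂ (suc k ∸ m)) (Q^-φ̂ m (suc k) (ℕ.m≤n⇒m≤1+n m≤k)) d) (Q-φ̂-∸ m≤k d)

    Q^-φ̂-vanishes : ∀ m k → k < m → (Q ^O m) (φ̂ k) ≈P zeroP
    Q^-φ̂-vanishes (suc m) k (s≤s k≤m) d with ℕ.m≤n⇒m<n∨m≡n k≤m
    ... | inj₁ k<m    = trans (Q-cong _ zeroP (Q^-φ̂-vanishes m k k<m) d)
                              (IsLinear-zeroP Q-linear zeroP (λ _ → refl) d)
    ... | inj₂ ≡.refl = trans (Q-cong _ (φ̂ 0) Q^kφ̂k≈φ̂0 d) (Q-φ̂-zero d)
      where
      Q^kφ̂k≈φ̂0 : (Q ^O k) (φ̂ k) ≈P φ̂ 0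
      Q^kφ̂k≈φ̂0 = ≡.subst (λ j → (Q ^O k) (φ̂ k) ≈P φ̂ j) (ℕ.n∸n≡0 k) (Q^-φ̂ k k ℕ.≤-refl)

    module Expansion (p : ℕ → Poly) (Q-p-zero : Q (p 0) ≈P zeroP) (Q-p-suc : ∀ n → Q (p (suc n)) ≈P p n) where

      expansion : Carrier → ℕ → Poly
      expansion u n = ΣP< (suc n) (λ j → scale (eval u (p j)) (φ̂ (n ∸ j)))

      Q-ΣP< : ∀ n f → Q (ΣP< n f) ≈P ΣP< n (λ j → Q (f j))
      Q-ΣP< zero    f = IsLinear-zeroP Q-linear zeroP (λ _ → refl)
      Q-ΣP< (suc n) f d = trans (additive (ΣP< n f) (f n) d) (+-congʳ (Q-ΣP< n f d))

      coeff-Q-expansion : ∀ u n d →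
        coeff (Q (expansion u n)) d ≈ Σ< (suc n) (λ j → eval u (p j) * coeff (Q (φ̂ (n ∸ j))) d)
      coeff-Q-expansion u n d = trans (Q-ΣP< (suc n) _ d)
        (trans (coeff-ΣP< (suc n) _ d) (Σ<-cong (suc n) (λ j → homogeneous _ (φ̂ (n ∸ j)) d)))

      Q-expansion-zero : ∀ u → Q (expansion u 0) ≈P zeroP
      Q-expansion-zero u d = trans (coeff-Q-expansion u 0 d)
        (trans (+-identityˡ _) (trans (*-congˡ (Q-φ̂-zero d)) (zeroʳ _)))

      Q-expansion-suc : ∀ u n → Q (expansion u (suc n)) ≈P expansion u n
      Q-expansion-suc u n d = begin
        coeff (Q (expansion u (suc n))) d
          ≈⟨ coeff-Q-expansion u (suc n) d ⟩
        Σ< (suc n) (λ j → eval u (p j) * coeff (Q (φ̂ (suc n ∸ j))) d)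
          + eval u (p (suc n)) * coeff (Q (φ̂ (n ∸ n))) d
          ≈⟨ +-cong (Σ<-cong-< (suc n) (λ j j≤n → *-congˡ (Q-φ̂-∸ (ℕ.≤-pred j≤n) d))) last≈0 ⟩
        Σ< (suc n) (λ j → eval u (p j) * coeff (φ̂ (n ∸ j)) d) + 0#
          ≈⟨ trans (+-identityʳ _) (sym (coeff-ΣP< (suc n) _ d)) ⟩
        coeff (expansion u n) d
          ∎
        where
        last≈0 : eval u (p (suc n)) * coeff (Q (φ̂ (n ∸ n))) d ≈ 0#
        last≈0 rewrite ℕ.n∸n≡0 n = trans (*-congˡ (Q-φ̂-zero d)) (zeroʳ _)

      eval-0-expansion : ∀ u n → eval 0# (expansion u n) ≈ eval u (p n)
      eval-0-expansion u n = begin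
        eval 0# (expansion u n)
          ≈⟨ eval-ΣP< 0# (suc n) _ ⟩
        Σ< n (λ j → eval 0# (scale (α j) (φ̂ (n ∸ j)))) + eval 0# (scale (α n) (φ̂ (n ∸ n)))
          ≈⟨ +-cong (Σ<-zero n _ (λ j j<n → trans (eval-scale 0# (α j) (φ̂ (n ∸ j)))
                                                  (trans (*-congˡ (φ̂-at-0 j<n)) (zeroʳ _))))
                    (trans (eval-scale 0# (α n) (φ̂ (n ∸ n))) (*-congˡ last)) ⟩
        0# + α n * 1#
          ≈⟨ trans (+-identityˡ _) (*-identityʳ _) ⟩
        eval u (p n)
          ∎
        where
        α : ℕ → Carrier
        α j = eval u (p j)
        φ̂-at-0 : ∀ {j} → j < n → eval 0# (φ̂ (n ∸ j)) ≈ 0#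
        φ̂-at-0 {j} j<n rewrite ℕ.+-∸-assoc 1 j<n = eval-0-φ̂-suc (n ∸ suc j)
        last : eval 0# (φ̂ (n ∸ n)) ≈ 1#
        last rewrite ℕ.n∸n≡0 n = eval-φ̂-zero 0#

      E-expansion : ∀ u n → E u (p n) ≈P expansion u n
      Q-E≈Q-expansion : ∀ u n → Q (E u (p n)) ≈P Q (expansion u n)

      E-expansion u n = Q∧eval0-injective (E u (p n)) (expansion u n) (Q-E≈Q-expansion u n)
        (trans (eval-E 0# u (p n)) (trans (eval-cong-point (p n) (+-identityˡ u)) (sym (eval-0-expansion u n))))

      Q-E≈Q-expansion u zero    d = trans (Q-shift u (p 0) d)
        (trans (E-cong u {Q (p 0)} {zeroP} Q-p-zero d) (sym (Q-expansion-zero u d)))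
      Q-E≈Q-expansion u (suc n) d = trans (Q-shift u (p (suc n)) d)
        (trans (E-cong u {Q (p (suc n))} {p n} (Q-p-suc n) d)
               (trans (E-expansion u n d) (sym (Q-expansion-suc u n d))))

      eval-+-expansion : ∀ u v n →
        eval (v + u) (p n) ≈ Σ< (suc n) (λ j → eval u (p j) * eval v (φ̂ (n ∸ j)))
      eval-+-expansion u v n = begin
        eval (v + u) (p n)          ≈⟨ sym (eval-E v u (p n)) ⟩
        eval v (E u (p n))          ≈⟨ eval-cong v {E u (p n)} {expansion u n} (E-expansion u n) ⟩
        eval v (expansion u n)      ≈⟨ eval-ΣP< v (suc n) _ ⟩
        Σ< (suc n) (λ j → eval v (scale (eval u (p j)) (φ̂ (n ∸ j))))
          ≈⟨ Σ<-cong (suc n) (λ j → eval-scale v (eval u (p j)) (φ̂ (n ∸ j))) ⟩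
        Σ< (suc n) (λ j → eval u (p j) * eval v (φ̂ (n ∸ j)))  ∎

module ShiftedSigma {c ℓ} (K : CharZeroField c ℓ) where
  open CharZeroField K
  open Theory K
  open RingProperties ring using ([y-z]x≈yx-zx)
  open PolynomialFunctions K
  open PowerSeries K
  open LinearMaps K
  open DeltaOperators K
  open IntegerRingSolver commutativeRing using (solve; _:=_; _:+_; _:*_; _:-_)
  open SetoidReasoning setoid

  module SigmaExpansion (Q R : Op) (Q-delta : IsDelta Q) (R-delta : IsDelta R)
                        (P S Sinv : Series) (Q-form : IsDeltaForm Q P) (R-form : IsDeltaForm R S)
                        (Sinv-inverse : IsSeriesInverse S Sinv)
                        (φseq : ℕ → Poly) (φ : Op) (umbral : IsUmbral Q φseq φ)
                        (Rinv : Op) (sigma : IsSigma R Rinv) where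


    Q-linear : IsLinear Q
    Q-linear = proj₁ Q-delta

    open DeltaOperator Q Q-linear (proj₁ (proj₂ Q-delta)) P Q-form φseq φ umbral

    -- T is the power series of Q/R, so that s = (Q/R) φ and ŝ n = s xⁿ / n!.
    T : Series
    T = P ⋆ Sinv

    s : Op
    s = applySeries T ∘O φ

    ŝ : ℕ → Poly
    ŝ n = applySeries T (φ̂ n)

    Q-ŝ-zero : Q (ŝ 0) ≈P zeroP
    Q-ŝ-zero d = trans (Q-applySeries T (φ̂ 0) d) (applySeries-cong T {Q (φ̂ 0)} {zeroP} Q-φ̂-zero d)

    Q-ŝ-suc : ∀ n → Q (ŝ (suc n)) ≈P ŝ n
    Q-ŝ-suc n d = trans (Q-applySeries T (φ̂ (suc n)) d)
                        (applySeries-cong T {Q (φ̂ (suc n))} {φ̂ n} (Q-φ̂-suc n) d)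

    open Expansion ŝ Q-ŝ-zero Q-ŝ-suc using (eval-+-expansion)

    S∘T≈P : ∀ h → applySeries S (applySeries T h) ≈P applySeries P h
    S∘T≈P h d = begin
      coeff (applySeries S (applySeries T h)) d
        ≈⟨ applySeries-cong S {applySeries T h} {applySeries P (applySeries Sinv h)}
                             (λ d′ → sym (applySeries-⋆ P Sinv h d′)) d ⟩
      coeff (applySeries S (applySeries P (applySeries Sinv h))) d
        ≈⟨ applySeries-comm S P (applySeries Sinv h) d ⟩
      coeff (applySeries P (applySeries S (applySeries Sinv h))) d
        ≈⟨ applySeries-cong P {applySeries S (applySeries Sinv h)} {h}
             (λ d′ → trans (applySeries-⋆ S Sinv h d′)
                           (trans (applySeries-cong-series h Sinv-inverse d′) (applySeries-oneS h d′))) d ⟩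
      coeff (applySeries P h) d
        ∎

    R∘T≈Q : ∀ h → R (applySeries T h) ≈P Q h
    R∘T≈Q h d = trans (proj₂ R-form (applySeries T h) d)
      (trans (DP-cong {applySeries S (applySeries T h)} {applySeries P h} (S∘T≈P h) d) (sym (Q≈DP∘P h d)))

    R-ŝ-suc : ∀ n → R (ŝ (suc n)) ≈P φ̂ n
    R-ŝ-suc n d = trans (R∘T≈Q (φ̂ (suc n)) d) (Q-φ̂-suc n d)

    eval-ŝ-zero : ∀ u → eval u (ŝ 0) ≈ eval 0# (ŝ 0)
    eval-ŝ-zero u = begin
      eval u (ŝ 0)                          ≈⟨ eval-cong-point (ŝ 0) (sym (+-identityʳ u)) ⟩
      eval (u + 0#) (ŝ 0)                   ≈⟨ eval-+-expansion 0# u 0 ⟩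
      0# + eval 0# (ŝ 0) * eval u (φ̂ 0)     ≈⟨ trans (+-identityˡ _) (trans (*-congˡ (eval-φ̂-zero u)) (*-identityʳ _)) ⟩
      eval 0# (ŝ 0)                         ∎

    eval-ŝ-suc : ∀ m u → eval u (ŝ (suc m)) ≈ invFact (suc m) * eval u (s (X^ (suc m)))
    eval-ŝ-suc m u = trans (eval-cong u {ŝ (suc m)} {scale (invFact (suc m)) (s (X^ (suc m)))} ŝ≈s)
      (eval-scale u (invFact (suc m)) (s (X^ (suc m))))
      where
      ŝ≈s : ŝ (suc m) ≈P scale (invFact (suc m)) (s (X^ (suc m)))
      ŝ≈s d = trans (applySeries-scale T (invFact (suc m)) (φseq (suc m)) d)
        (*-congˡ (applySeries-cong T {φseq (suc m)} {φ (X^ (suc m))}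
                                   (λ d′ → sym (IsUmbral.onMonomials umbral (suc m) d′)) d))

    eval-shiftedSigma-φ̂ : ∀ a k t →
      eval t (shiftedSigma Rinv a (φ̂ k)) ≈ eval t (ŝ (suc k)) - eval a (ŝ (suc k))
    eval-shiftedSigma-φ̂ a k t = begin
      eval t (shiftedSigma Rinv a (φ̂ k))
        ≈⟨ eval-E t (- a) (Rinv (E a (φ̂ k))) ⟩
      eval (t - a) (Rinv (E a (φ̂ k)))
        ≈⟨ eval-cong (t - a) {Rinv (E a (φ̂ k))} {G -P 𝓔 0# G} Rinv-G ⟩
      eval (t - a) (G -P 𝓔 0# G)
        ≈⟨ eval-- (t - a) G (𝓔 0# G) ⟩
      eval (t - a) G - eval (t - a) (𝓔 0# G)
        ≈⟨ +-congˡ (-‿cong (eval-constP (t - a) (eval 0# G))) ⟩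
      eval (t - a) G - eval 0# G
        ≈⟨ +-cong (trans (eval-E (t - a) a ŝₖ₊₁)
                         (eval-cong-point ŝₖ₊₁ (solve 2 (λ t a → (t :- a) :+ a := t) refl t a)))
                  (-‿cong (trans (eval-E 0# a ŝₖ₊₁) (eval-cong-point ŝₖ₊₁ (+-identityˡ a)))) ⟩
      eval t ŝₖ₊₁ - eval a ŝₖ₊₁
        ∎
      where
      ŝₖ₊₁ : Poly
      ŝₖ₊₁ = ŝ (suc k)
      G : Poly
      G = E a ŝₖ₊₁
      Rinv-G : Rinv (E a (φ̂ k)) ≈P G -P 𝓔 0# G
      Rinv-G d = trans (IsLinear.cong (IsSigma.linear sigma) (E a (φ̂ k)) (R G)
                          (λ d′ → trans (E-cong a {φ̂ k} {R ŝₖ₊₁} (λ d″ → sym (R-ŝ-suc k d″)) d′)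
                                        (sym (proj₁ (proj₂ R-delta) a ŝₖ₊₁ d′))) d)
                       (IsSigma.left sigma G d)

    weight : Carrier → Carrier → ℕ → Carrier
    weight a t m = eval 0# (ŝ (suc m)) - eval (a - t) (ŝ (suc m))

    eval-ŝ-suc-expansion : ∀ u t k → eval (t + u) (ŝ (suc k)) ≈
      eval 0# (ŝ 0) * eval t (φ̂ (suc k)) + Σ< (suc k) (λ m → eval u (ŝ (suc m)) * eval t (φ̂ (k ∸ m)))
    eval-ŝ-suc-expansion u t k =
      trans (eval-+-expansion u t (suc k)) (trans (Σ<-head (suc k) _) (+-congʳ (*-congʳ (eval-ŝ-zero u))))

    eval-ŝ-difference : ∀ a t k → eval t (ŝ (suc k)) - eval a (ŝ (suc k)) ≈
      Σ< (suc k) (λ m → weight a t m * eval t (φ̂ (k ∸ m)))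
    eval-ŝ-difference a t k = begin
      eval t (ŝ (suc k)) - eval a (ŝ (suc k))
        ≈⟨ +-cong (eval-cong-point (ŝ (suc k)) (sym (+-identityʳ t)))
                  (-‿cong (eval-cong-point (ŝ (suc k)) (solve 2 (λ a t → a := t :+ (a :- t)) refl a t))) ⟩
      eval (t + 0#) (ŝ (suc k)) - eval (t + (a - t)) (ŝ (suc k))
        ≈⟨ +-cong (eval-ŝ-suc-expansion 0# t k) (-‿cong (eval-ŝ-suc-expansion (a - t) t k)) ⟩
      (c₀ + Σ< (suc k) (λ m → x m * z m)) - (c₀ + Σ< (suc k) (λ m → y m * z m))
        ≈⟨ solve 3 (λ c X Y → (c :+ X) :- (c :+ Y) := X :- Y) refl _ _ _ ⟩
      Σ< (suc k) (λ m → x m * z m) - Σ< (suc k) (λ m → y m * z m)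
        ≈⟨ sym (trans (Σ<-cong (suc k) (λ m → [y-z]x≈yx-zx (z m) (x m) (y m))) (Σ<-distrib-- (suc k) _ _)) ⟩
      Σ< (suc k) (λ m → weight a t m * z m)
        ∎
      where
      c₀ : Carrier
      c₀ = eval 0# (ŝ 0) * eval t (φ̂ (suc k))
      x y z : ℕ → Carrier
      x m = eval 0# (ŝ (suc m))
      y m = eval (a - t) (ŝ (suc m))
      z m = eval t (φ̂ (k ∸ m))

    expansionTerm : Carrier → Poly → ℕ → Poly
    expansionTerm a f m = scale (invFact (suc m))
      (mulO (constP (eval 0# (s (X^ (suc m)))) -P comp (s (X^ (suc m))) (constP a -P xP)) ((Q ^O m) f))

    eval-expansionTerm : ∀ a f t m → eval t (expansionTerm a f m) ≈ weight a t m * eval t ((Q ^O m) f)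
    eval-expansionTerm a f t m = begin
      eval t (expansionTerm a f m)
        ≈⟨ eval-scale t i (mulO w ((Q ^O m) f)) ⟩
      i * eval t (mulO w ((Q ^O m) f))
        ≈⟨ *-congˡ (eval-* t w ((Q ^O m) f)) ⟩
      i * (eval t w * g)
        ≈⟨ *-congˡ (*-congʳ (trans (eval-- t (constP (sₘ₊₁ 0#)) (comp s′ a-x))
                                   (+-cong (eval-constP t _) (-‿cong (eval-comp t s′ a-x))))) ⟩
      i * ((sₘ₊₁ 0# - eval (eval t a-x) s′) * g)
        ≈⟨ *-congˡ (*-congʳ (+-congˡ (-‿cong (eval-cong-point s′
             (trans (eval-- t (constP a) xP) (+-cong (eval-constP t a) (-‿cong (eval-xP t)))))))) ⟩
      i * ((sₘ₊₁ 0# - sₘ₊₁ (a - t)) * g)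
        ≈⟨ solve 4 (λ i x y g → i :* ((x :- y) :* g) := (i :* x :- i :* y) :* g) refl i _ _ g ⟩
      (i * sₘ₊₁ 0# - i * sₘ₊₁ (a - t)) * g
        ≈⟨ *-congʳ (sym (+-cong (eval-ŝ-suc m 0#) (-‿cong (eval-ŝ-suc m (a - t))))) ⟩
      weight a t m * g
        ∎
      where
      i : Carrier
      i = invFact (suc m)
      s′ : Poly
      s′ = s (X^ (suc m))
      a-x : Poly
      a-x = constP a -P xP
      w : Poly
      w = constP (eval 0# s′) -P comp s′ a-x
      g : Carrier
      g = eval t ((Q ^O m) f)
      sₘ₊₁ : Carrier → Carrier
      sₘ₊₁ u = eval u s′

    weightedΣ<-Q^-φ̂ : ∀ a t {k M} → k < M →
      Σ< M (λ m → weight a t m * eval t ((Q ^O m) (φ̂ k)))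
        ≈ Σ< (suc k) (λ m → weight a t m * eval t (φ̂ (k ∸ m)))
    weightedΣ<-Q^-φ̂ a t {k} {M} k<M = begin
      Σ< M (λ m → weight a t m * eval t ((Q ^O m) (φ̂ k)))
        ≈⟨ Σ<-extend _ k<M (λ m k<m →
             trans (*-congˡ (eval-cong t {(Q ^O m) (φ̂ k)} {zeroP} (Q^-φ̂-vanishes m k k<m))) (zeroʳ _)) ⟩
      Σ< (suc k) (λ m → weight a t m * eval t ((Q ^O m) (φ̂ k)))
        ≈⟨ Σ<-cong-< (suc k) (λ m m≤k →
             *-congˡ (eval-cong t {(Q ^O m) (φ̂ k)} {φ̂ (k ∸ m)} (Q^-φ̂ m k (ℕ.≤-pred m≤k)))) ⟩
      Σ< (suc k) (λ m → weight a t m * eval t (φ̂ (k ∸ m)))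
        ∎

    shiftedSigma-expansion : ∀ a f M → bound f ≤ M → shiftedSigma Rinv a f ≈P ΣP< M (expansionTerm a f)
    shiftedSigma-expansion a f M bound≤M =
      eval-injective (shiftedSigma Rinv a f) (ΣP< M (expansionTerm a f)) (λ t → begin
      eval t (shiftedSigma Rinv a f)
        ≈⟨ linearFunctionals-agree-on-basis (LHS-linear t) (RHS-linear t) φ̂ φ̂-hasDegree M (agree-on-φ̂ t)
             f (vanishesFrom-mono f bound≤M (vanish f)) ⟩
      Σ< M (λ m → weight a t m * eval t ((Q ^O m) f))
        ≈⟨ sym (trans (eval-ΣP< t M (expansionTerm a f)) (Σ<-cong M (eval-expansionTerm a f t))) ⟩
      eval t (ΣP< M (expansionTerm a f))
        ∎)
      where
      LHS-linear : ∀ t → IsLinearFunctional (λ g → eval t (shiftedSigma Rinv a g))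
      LHS-linear = eval∘-isLinearFunctional
        (IsLinear-∘ (E-isLinear (- a)) (IsLinear-∘ (IsSigma.linear sigma) (E-isLinear a)))
      RHS-linear : ∀ t → IsLinearFunctional (λ g → Σ< M (λ m → weight a t m * eval t ((Q ^O m) g)))
      RHS-linear t = weightedΣ<-isLinearFunctional M (weight a t)
        (λ m → eval∘-isLinearFunctional (IsLinear-^O Q-linear m) t)
      agree-on-φ̂ : ∀ t k → k < M →
        eval t (shiftedSigma Rinv a (φ̂ k)) ≈ Σ< M (λ m → weight a t m * eval t ((Q ^O m) (φ̂ k)))
      agree-on-φ̂ t k k<M =
        trans (eval-shiftedSigma-φ̂ a k t) (trans (eval-ŝ-difference a t k) (sym (weightedΣ<-Q^-φ̂ a t k<M)))

mainTheorem13 : ∀ {c ℓ} (K : CharZeroField c ℓ) →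
    let open CharZeroField K in
    let open Theory K in
    (Q R : Op) → IsDelta Q → IsDelta R →
    (P S Sinv : Series) → IsDeltaForm Q P → IsDeltaForm R S → IsSeriesInverse S Sinv →
    (φseq : ℕ → Poly) (φ : Op) → IsUmbral Q φseq φ →
    (Rinv : Op) → IsSigma R Rinv →
    let s = applySeries (P ⋆ Sinv) ∘O φ in
    (a : Carrier) (f : Poly) →
    Σ ℕ (λ N → (M : ℕ) → N ≤ M →
      shiftedSigma Rinv a f
        ≈P ΣP< M (λ m → scale (invFact (suc m))
                   (mulO (constP (eval 0# (s (X^ (suc m))))
                           -P comp (s (X^ (suc m))) (constP a -P xP))
                         ((Q ^O m) f))))
mainTheorem13 K Q R Q-delta R-delta P S Sinv Q-form R-form Sinv-inverse φseq φ umbral Rinv sigma a f =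
  bound f , shiftedSigma-expansion a f
  where
  open Theory K using (bound)
  open ShiftedSigma.SigmaExpansion K Q R Q-delta R-delta P S Sinv Q-form R-form Sinv-inverse φseq φ umbral Rinv sigma
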